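{- Let $w\in B_n$. (1) For $1\le i<j\le n$, the quantum Bruhat graph has an edge $w\xrightarrow{(i,j)}w(i,j)$ iff there is no $k$ with $i<k<j$ and $w(i)\prec w(k)\prec w(j)$ ($\prec$ the circular order starting at $w(i)$). (2) For $1\le i<j\le n$, it has an edge $w\xrightarrow{(i,\overline{\jmath})}w(i,\overline{\jmath})$ iff $w(i)<w(\overline{\jmath})$, $\mathrm{sign}(w(i))=\mathrm{sign}(w(\overline{\jmath}))$, and there is no $k\in[\overline{n}]$ with $i<k<\overline{\jmath}$ and $w(i)<w(k)<w(\overline{\jmath})$. (3) For $1\le i\le n$, it has an edge $w\xrightarrow{(i,\overline{\imath})}w(i,\overline{\imath})$ iff there is no $k$ with $i<k<\overline{\imath}$ (equivalently $i<k\le n$) and $w(i)\prec w(k)\prec w(\overline{\imath})$ ($\prec$ the circular order starting at $w(i)$).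
   Context: $[\overline{n}]=\{1<\dots<n<\overline{n}<\overline{n-1}<\dots<\overline{1}\}$, $\overline{\overline{\imath}}=i$, $\mathrm{sign}(a)=+1$ for $a\in[n]$ and $-1$ for barred $a$; positions are also indexed by $[\overline{n}]$ with this order. $B_n$ is the group of signed permutations ($w(\overline{\imath})=\overline{w(i)}$), with length $\ell(w)=\#\{(k,l)\in[n]\times[\overline{n}]:k\le|l|,\ w(k)>w(l)\}$. $(i,j)$ ($i<j$) denotes the root $\varepsilon_i-\varepsilon_j$ and the reflection $t_{ij}t_{\overline{\jmath}\,\overline{\imath}}$; $(i,\overline{\jmath})$ ($i<j$) the root $\varepsilon_i+\varepsilon_j$ and reflection $t_{i\overline{\jmath}}t_{j\overline{\imath}}$; $(i,\overline{\imath})$ the root $2\varepsilon_i$ and transposition $t_{i\overline{\imath}}$; right multiplication by $t_{ab}$ swaps entries in positions $a,b$. With $\rho=(n,n-1,\dots,1)$: $\langle\rho,(i,j)^\vee\rangle=j-i$, $\langle\rho,(i,\overline{\jmath})^\vee\rangle=2n+2-i-j$, $\langle\rho,(i,\overline{\imath})^\vee\rangle=n+1-i$. The quantum Bruhat graph has an edge $w\xrightarrow{\alpha}ws_\alpha$ for positive root $\alpha$ iff $\ell(ws_\alpha)=\ell(w)+1$ or $\ell(ws_\alpha)=\ell(w)-2\langle\rho,\alpha^\vee\rangle+1$. The circular order starting at $a\in[\overline{n}]$ lists $[\overline{n}]$ cyclically in the order $1,\dots,n,\overline{n},\dots,\overline{1}$ beginning at $a$. -}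

module Defs where

open import Data.Nat using (ℕ; zero; suc; _+_; _*_; _∸_; _<_; _≤_; _≤?_; _<?_)
open import Data.Bool using (Bool; true; false; if_then_else_)
open import Data.Fin using (Fin; toℕ; opposite; _↑ˡ_; _≟_)
open import Data.List using (List; map; allFin)
open import Data.Nat.ListAction using (sum)
open import Data.Product using (Σ; _×_; ∃-syntax)
open import Data.Sum using (_⊎_)
open import Relation.Nullary using (¬_; does)
open import Relation.Binary.PropositionalEquality using (_≡_)
open import Function.Definitions using (Injective)

-- The totally ordered set [n̄] = {1 < … < n < n̄ < … < 1̄} is encoded as
-- a wrapper around Fin (n + n): index p (0-based) < n stands for the letter p+1, and
-- index n + q stands for the barred letter (n - q)‾.  The linear order of
-- [n̄] is the order of indices (toℕ).  Positions are indexed the same way.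
record Letter (n : ℕ) : Set where
  constructor ⟨_⟩
  field idx : Fin (n + n)
open Letter public

bar : ∀ {n} → Letter n → Letter n
bar ⟨ p ⟩ = ⟨ opposite p ⟩

pos : ∀ {n} → Fin n → Letter n
pos {n} i = ⟨ i ↑ˡ n ⟩

-- sign(a) = +1 (true) for a ∈ [n], -1 (false) for barred a
sign : ∀ {n} → Letter n → Bool
sign {n} a = does (toℕ (idx a) <? n)

absIdx : ∀ {n} → Letter n → ℕ
absIdx {n} l = if does (toℕ (idx l) <? n) then toℕ (idx l) else toℕ (idx (bar l))

-- Signed permutations: bijections of [n̄] (injective suffices, being finite)
-- with w(ī) = overline(w(i)).
record SignedPerm (n : ℕ) : Set where
  field
    fun     : Letter n → Letter n
    inj     : Injective _≡_ _≡_ fun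
    bar-com : ∀ a → fun (bar a) ≡ bar (fun a)
open SignedPerm public

ind : Bool → ℕ
ind true  = 1
ind false = 0

-- ℓ(w) = #{(k,l) ∈ [n] × [n̄] : k ≤ |l|, w(k) > w(l)}
len : ∀ {n} → (Letter n → Letter n) → ℕ
len {n} w =
  sum (map (λ k → sum (map (λ l →
        ind (does (toℕ k ≤? absIdx {n} ⟨ l ⟩)) *
        ind (does (toℕ (idx (w ⟨ l ⟩)) <? toℕ (idx (w (pos k)))))) (allFin (n + n))))
      (allFin n))

data PosRoot (n : ℕ) : Set where
  rij    : (i j : Fin n) → toℕ i < toℕ j → PosRoot n   -- ε_i - ε_j
  rijbar : (i j : Fin n) → toℕ i < toℕ j → PosRoot n   -- ε_i + ε_j
  riibar : (i : Fin n) → PosRoot n                     -- 2 ε_i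

swap : ∀ {n} → Letter n → Letter n → Letter n → Letter n
swap a b p = if does (idx p ≟ idx a) then b else (if does (idx p ≟ idx b) then a else p)

refl : ∀ {n} → PosRoot n → Letter n → Letter n
refl (rij i j _)    p = swap (pos i) (pos j) (swap (bar (pos j)) (bar (pos i)) p)
refl (rijbar i j _) p = swap (pos i) (bar (pos j)) (swap (pos j) (bar (pos i)) p)
refl (riibar i)     p = swap (pos i) (bar (pos i)) p

rmul : ∀ {n} → (Letter n → Letter n) → PosRoot n → Letter n → Letter n
rmul w α p = w (refl α p)

-- ⟨ρ, α^∨⟩ with ρ = (n, n-1, …, 1), translated to 0-based indices
rhoPair : ∀ {n} → PosRoot n → ℕ
rhoPair     (rij i j _)    = toℕ j ∸ toℕ i
rhoPair {n} (rijbar i j _) = (n + n) ∸ (toℕ i + toℕ j)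
rhoPair {n} (riibar i)     = n ∸ toℕ i

-- quantum Bruhat graph edge w --α--> w s_α :
--   ℓ(w s_α) = ℓ(w) + 1   or   ℓ(w s_α) = ℓ(w) - 2⟨ρ,α^∨⟩ + 1
-- (the latter written without subtraction as ℓ(w s_α) + 2⟨ρ,α^∨⟩ = ℓ(w) + 1)
QBGEdge : ∀ {n} → SignedPerm n → PosRoot n → Set
QBGEdge w α =
  len (rmul (fun w) α) ≡ suc (len (fun w))
  ⊎ len (rmul (fun w) α) + 2 * rhoPair α ≡ suc (len (fun w))

circ : ∀ {n} → Letter n → Letter n → ℕ
circ {n} a x =
  if does (toℕ (idx a) ≤? toℕ (idx x)) then toℕ (idx x) ∸ toℕ (idx a)
  else (toℕ (idx x) + (n + n)) ∸ toℕ (idx a)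

_≺[_]_ : ∀ {n} → Letter n → Letter n → Letter n → Set
x ≺[ a ] y = circ a x < circ a y

_<L_ : ∀ {n} → Letter n → Letter n → Set
a <L b = toℕ (idx a) < toℕ (idx b)

-- Write U p for the index of w(p) in [n̄], so that U p̄ = 2n − 1 − U p. Then 2ℓ(w) = inv U + neg U,
-- where inv U counts the inversions of U as a permutation of the 2n positions and neg U the barred
-- values among w(1), …, w(n). Right multiplication by s_α swaps one or two pairs of positions, and
-- swapping positions a < b with U a < U b raises inv U by 1 + 2·#{a < k < b : U a < U k < U b},
-- while neg U only changes at the swapped positions. Hence ℓ(ws_α) − ℓ(w) − 1 counts, with
-- multiplicity, the values caught between the swapped ones: an upward edge means that none is
-- caught, and a downward edge, read off from the same formula applied to ws_α, means that every
-- position in between is caught, which is the circular-order condition. For ε_i + ε_j the signs of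
-- w(i) and w(j̄) decide whether neg U changes, and a change rules the edge out.

module Submission where

open import Defs renaming (refl to reflection)
open import Data.Bool using (true; false; if_then_else_)
open import Data.Empty using (⊥-elim)
open import Data.Fin using (Fin; zero; suc; toℕ; opposite; fromℕ<; _↑ˡ_; _↑ʳ_; _≟_)
open import Data.Fin.Permutation using (permutation)
open import Data.Fin.Permutation.Components using (transpose)
open import Data.Fin.Properties using (opposite-involutive; opposite-prop; toℕ-injective; toℕ<n; toℕ-↑ˡ; toℕ-↑ʳ; toℕ-fromℕ<)
open import Data.List using (map; tabulate)
open import Data.Nat using (ℕ; zero; suc; _+_; _*_; _∸_; _<_; _≤_; _≤?_; _<?_; z≤n; s≤s; NonZero)
import Data.Nat.ListAction as ListAction
open import Data.Nat.Properties hiding (_≟_)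
open import Data.Nat.Properties using () renaming (_≟_ to _≟ℕ_)
open import Data.Nat.Tactic.RingSolver using (solve-∀)
open import Data.Product using (_×_; _,_; proj₁; proj₂; ∃; ∃-syntax)
open import Data.Sum using (_⊎_; inj₁; inj₂)
open import Function using (_∘_)
open import Function.Bundles using (_⇔_; mk⇔; Equivalence)
open import Function.Properties.Equivalence using () renaming (trans to ⇔-trans)
open import Function.Related.TypeIsomorphisms using (¬-cong-⇔)
open import Relation.Binary.Definitions using (Tri; tri<; tri≈; tri>)
open import Relation.Binary.PropositionalEquality using (_≡_; refl; sym; trans; cong; cong₂; subst; subst₂; module ≡-Reasoning)
open import Relation.Nullary using (¬_; Dec; yes; no; does)
open import Relation.Nullary.Decidable using (dec-true; dec-false)
open import Algebra.Properties.Semiring.Sum +-*-semiring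
  using (sum; ∑-distrib-+; ∑-comm; ∑-permute; sum-cong-≗; sum-replicate-zero; *-distribˡ-sum)

𝟙 : ∀ {p} {P : Set p} → Dec P → ℕ
𝟙 d = ind (does d)

𝟙-yes : ∀ {p} {P : Set p} (d : Dec P) → P → 𝟙 d ≡ 1
𝟙-yes (yes _) _ = refl
𝟙-yes (no ¬p) p = ⊥-elim (¬p p)

𝟙-no : ∀ {p} {P : Set p} (d : Dec P) → ¬ P → 𝟙 d ≡ 0
𝟙-no (yes p) ¬p = ⊥-elim (¬p p)
𝟙-no (no _) _ = refl

𝟙≤1 : ∀ {p} {P : Set p} (d : Dec P) → 𝟙 d ≤ 1
𝟙≤1 (yes _) = s≤s z≤n
𝟙≤1 (no _) = z≤n

𝟙-cong : ∀ {P Q : Set} (dP : Dec P) (dQ : Dec Q) → (P → Q) → (Q → P) → 𝟙 dP ≡ 𝟙 dQ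
𝟙-cong (yes p) (yes q) f g = refl
𝟙-cong (yes p) (no ¬q) f g = ⊥-elim (¬q (f p))
𝟙-cong (no ¬p) (yes q) f g = ⊥-elim (¬p (g q))
𝟙-cong (no ¬p) (no ¬q) f g = refl

𝟙*𝟙≤1 : ∀ {P Q : Set} (dP : Dec P) (dQ : Dec Q) → 𝟙 dP * 𝟙 dQ ≤ 1
𝟙*𝟙≤1 (yes _) (yes _) = s≤s z≤n
𝟙*𝟙≤1 (yes _) (no _) = z≤n
𝟙*𝟙≤1 (no _) _ = z≤n

𝟙*𝟙≡1⇒× : ∀ {P Q : Set} (dP : Dec P) (dQ : Dec Q) → 𝟙 dP * 𝟙 dQ ≡ 1 → P × Q
𝟙*𝟙≡1⇒× (yes p) (yes q) _ = p , q
𝟙*𝟙≡1⇒× (yes p) (no q) ()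
𝟙*𝟙≡1⇒× (no p) _ ()

×⇒𝟙*𝟙≡1 : ∀ {P Q : Set} (dP : Dec P) (dQ : Dec Q) → P × Q → 𝟙 dP * 𝟙 dQ ≡ 1
×⇒𝟙*𝟙≡1 dP dQ (p , q) = cong₂ _*_ (𝟙-yes dP p) (𝟙-yes dQ q)

𝟙*𝟙≡0⇒¬× : ∀ {P Q : Set} (dP : Dec P) (dQ : Dec Q) → 𝟙 dP * 𝟙 dQ ≡ 0 → ¬ (P × Q)
𝟙*𝟙≡0⇒¬× dP dQ e pq = 0≢1+n (trans (sym e) (×⇒𝟙*𝟙≡1 dP dQ pq))

¬×⇒𝟙*𝟙≡0 : ∀ {P Q : Set} (dP : Dec P) (dQ : Dec Q) → ¬ (P × Q) → 𝟙 dP * 𝟙 dQ ≡ 0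
¬×⇒𝟙*𝟙≡0 (yes p) (yes q) h = ⊥-elim (h (p , q))
¬×⇒𝟙*𝟙≡0 (yes p) (no q) h = refl
¬×⇒𝟙*𝟙≡0 (no p) _ h = refl

when : ∀ {p} {P : Set p} → Dec P → ℕ → ℕ
when d x = if does d then x else 0

when-* : ∀ {p} {P : Set p} (d : Dec P) (x y : ℕ) → when d x * y ≡ when d (x * y)
when-* (yes _) x y = refl
when-* (no _) x y = refl

𝟙-*-when : ∀ {p} {P : Set p} (d : Dec P) (y : ℕ) → 𝟙 d * y ≡ when d y
𝟙-*-when (yes _) y = +-identityʳ y
𝟙-*-when (no _) y = refl

[_<ᶠ_] : ∀ {M} → Fin M → Fin M → ℕ
[ p <ᶠ q ] = 𝟙 (toℕ p <? toℕ q)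

[<ᶠ]-irrefl : ∀ {M} (x : Fin M) → [ x <ᶠ x ] ≡ 0
[<ᶠ]-irrefl x = 𝟙-no (toℕ x <? toℕ x) (n≮n (toℕ x))

-- The decisions are passed as variables: `does (x <? y)` computes to a boolean test, which
-- `with` cannot abstract.
𝟙-≤+> : ∀ (x y : ℕ) → 𝟙 (x ≤? y) + 𝟙 (y <? x) ≡ 1
𝟙-≤+> x y = go (x ≤? y) (y <? x)
  where
  go : (x≤y? : Dec (x ≤ y)) (y<x? : Dec (y < x)) → 𝟙 x≤y? + 𝟙 y<x? ≡ 1
  go (yes x≤y) (yes y<x) = ⊥-elim (<⇒≱ y<x x≤y)
  go (yes _) (no _) = refl
  go (no _) (yes _) = refl
  go (no x≰y) (no y≮x) = ⊥-elim (x≰y (≮⇒≥ y≮x))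

𝟙-≤-split : ∀ (x y : ℕ) → 𝟙 (x ≤? y) ≡ 𝟙 (x <? y) + 𝟙 (x ≟ℕ y)
𝟙-≤-split x y with <-cmp x y
... | tri< x<y x≢y _ = trans (𝟙-yes (x ≤? y) (<⇒≤ x<y)) (sym (cong₂ _+_ (𝟙-yes (x <? y) x<y) (𝟙-no (x ≟ℕ y) x≢y)))
... | tri≈ x≮y refl _ = trans (𝟙-yes (x ≤? x) ≤-refl) (sym (cong₂ _+_ (𝟙-no (x <? x) x≮y) (𝟙-yes (x ≟ℕ x) refl)))
... | tri> x≮y x≢y y<x = trans (𝟙-no (x ≤? y) (<⇒≱ y<x)) (sym (cong₂ _+_ (𝟙-no (x <? y) x≮y) (𝟙-no (x ≟ℕ y) x≢y)))

𝟙-window : ∀ {x y z : ℕ} → x < y → ¬ z ≡ x → ¬ z ≡ y →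
           𝟙 (z <? x) + 𝟙 (y <? z) + 2 * (𝟙 (x <? z) * 𝟙 (z <? y)) ≡ 𝟙 (x <? z) + 𝟙 (z <? y)
𝟙-window {x} {y} {z} x<y z≢x z≢y = go (z <? x) (y <? z) (x <? z) (z <? y)
  where
  go : (z<x? : Dec (z < x)) (y<z? : Dec (y < z)) (x<z? : Dec (x < z)) (z<y? : Dec (z < y)) →
       𝟙 z<x? + 𝟙 y<z? + 2 * (𝟙 x<z? * 𝟙 z<y?) ≡ 𝟙 x<z? + 𝟙 z<y?
  go (yes z<x) _ (yes x<z) _ = ⊥-elim (<-asym z<x x<z)
  go _ (yes y<z) _ (yes z<y) = ⊥-elim (<-asym y<z z<y)
  go (yes z<x) (yes y<z) _ _ = ⊥-elim (<-asym (<-trans z<x x<y) y<z)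
  go (yes _) (no _) (no _) (yes _) = refl
  go (yes z<x) (no _) (no _) (no z≮y) = ⊥-elim (z≮y (<-trans z<x x<y))
  go (no _) (yes _) (yes _) (no _) = refl
  go (no _) (yes y<z) (no x≮z) _ = ⊥-elim (x≮z (<-trans x<y y<z))
  go (no _) (no _) (yes _) (yes _) = refl
  go (no z≮x) (no _) (no x≮z) _ = ⊥-elim (z≢x (≤-antisym (≮⇒≥ x≮z) (≮⇒≥ z≮x)))
  go (no _) (no y≮z) _ (no z≮y) = ⊥-elim (z≢y (≤-antisym (≮⇒≥ y≮z) (≮⇒≥ z≮y)))


sum-zero : ∀ {m} (f : Fin m → ℕ) → (∀ i → f i ≡ 0) → sum f ≡ 0
sum-zero {m} f h = trans (sum-cong-≗ h) (sum-replicate-zero m)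

sum≡0⇒ : ∀ {m} (f : Fin m → ℕ) → sum f ≡ 0 → ∀ i → f i ≡ 0
sum≡0⇒ {suc m} f e zero = m+n≡0⇒m≡0 (f zero) e
sum≡0⇒ {suc m} f e (suc i) = sum≡0⇒ (f ∘ suc) (m+n≡0⇒n≡0 (f zero) e) i

sum-mono-≤ : ∀ {m} (f g : Fin m → ℕ) → (∀ i → f i ≤ g i) → sum f ≤ sum g
sum-mono-≤ {zero} f g h = z≤n
sum-mono-≤ {suc m} f g h = +-mono-≤ (h zero) (sum-mono-≤ (f ∘ suc) (g ∘ suc) (h ∘ suc))

sum-≤-≡⇒≗ : ∀ {m} (f g : Fin m → ℕ) → (∀ i → f i ≤ g i) → sum f ≡ sum g → ∀ i → f i ≡ g i
sum-≤-≡⇒≗ {suc m} f g f≤g e = pointwise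
  where
  head≡ : f zero ≡ g zero
  head≡ = ≤-antisym (f≤g zero)
    (+-cancelʳ-≤ _ _ _ (≤-trans (≤-reflexive (sym e)) (+-monoʳ-≤ (f zero) (sum-mono-≤ _ _ (f≤g ∘ suc)))))
  pointwise : ∀ i → f i ≡ g i
  pointwise zero = head≡
  pointwise (suc i) = sum-≤-≡⇒≗ (f ∘ suc) (g ∘ suc) (f≤g ∘ suc)
    (+-cancelˡ-≡ (f zero) _ _ (trans e (cong (_+ _) (sym head≡)))) i

sum-δ : ∀ {m} (c : Fin m) (H : Fin m → ℕ) → sum (λ p → when (p ≟ c) (H p)) ≡ H c
sum-δ {suc m} zero H = trans (cong (H zero +_) (sum-zero {m} _ (λ _ → refl))) (+-identityʳ (H zero))
sum-δ {suc m} (suc c) H = sum-δ c (H ∘ suc)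

sum-<-count : ∀ m c → c ≤ m → sum {m} (λ k → 𝟙 (toℕ k <? c)) ≡ c
sum-<-count zero .zero z≤n = refl
sum-<-count (suc m) zero _ = sum-zero {suc m} _ (λ _ → refl)
sum-<-count (suc m) (suc c) (s≤s c≤m) = cong suc (sum-<-count m c c≤m)

sum-↑ : ∀ m k (f : Fin (m + k) → ℕ) → sum f ≡ sum (λ i → f (i ↑ˡ k)) + sum (λ i → f (m ↑ʳ i))
sum-↑ zero k f = refl
sum-↑ (suc m) k f = trans (cong (f zero +_) (sum-↑ m k (f ∘ suc))) (sym (+-assoc (f zero) _ _))

sum-involution : ∀ {m} (σ : Fin m → Fin m) → (∀ i → σ (σ i) ≡ i) → (f : Fin m → ℕ) → sum f ≡ sum (f ∘ σ)
sum-involution σ inv f = ∑-permute f (permutation σ σ inv inv)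

sum-update : ∀ {m} (f g : Fin m → ℕ) (c : Fin m) → (∀ p → ¬ p ≡ c → f p ≡ g p) → sum f + g c ≡ sum g + f c
sum-update f g c agree = begin
  sum f + g c                                ≡⟨ cong (sum f +_) (sym (sum-δ c g)) ⟩
  sum f + sum (λ p → when (p ≟ c) (g p))     ≡⟨ sym (∑-distrib-+ f _) ⟩
  sum (λ p → f p + when (p ≟ c) (g p))       ≡⟨ sum-cong-≗ swapped ⟩
  sum (λ p → g p + when (p ≟ c) (f p))       ≡⟨ ∑-distrib-+ g _ ⟩
  sum g + sum (λ p → when (p ≟ c) (f p))     ≡⟨ cong (sum g +_) (sum-δ c f) ⟩
  sum g + f c                                ∎
  where
  open ≡-Reasoning
  swapped : ∀ p → f p + when (p ≟ c) (g p) ≡ g p + when (p ≟ c) (f p)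
  swapped p with p ≟ c
  ... | yes refl = +-comm (f p) (g p)
  ... | no p≢c = cong (_+ 0) (agree p p≢c)

sum₂ : ∀ {M} → (Fin M → Fin M → ℕ) → ℕ
sum₂ f = sum λ p → sum (f p)

sum₂-cong : ∀ {M} {f g : Fin M → Fin M → ℕ} → (∀ p q → f p q ≡ g p q) → sum₂ f ≡ sum₂ g
sum₂-cong h = sum-cong-≗ (λ p → sum-cong-≗ (h p))

sum₂-distrib-+ : ∀ {M} (f g : Fin M → Fin M → ℕ) → sum₂ (λ p q → f p q + g p q) ≡ sum₂ f + sum₂ g
sum₂-distrib-+ f g = trans (sum-cong-≗ (λ p → ∑-distrib-+ (f p) (g p))) (∑-distrib-+ (λ p → sum (f p)) (λ p → sum (g p)))

sum₂-δˡ : ∀ {M} (c : Fin M) (G : Fin M → Fin M → ℕ) → sum₂ (λ p q → when (p ≟ c) (G p q)) ≡ sum (G c)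
sum₂-δˡ {M} c G = trans (sum-cong-≗ row) (sum-δ c (λ p → sum (G p)))
  where
  row : ∀ p → sum (λ q → when (p ≟ c) (G p q)) ≡ when (p ≟ c) (sum (G p))
  row p with p ≟ c
  ... | yes _ = refl
  ... | no _ = sum-zero {M} _ (λ _ → refl)

sum₂-δʳ : ∀ {M} (c : Fin M) (G : Fin M → Fin M → ℕ) → sum₂ (λ p q → when (q ≟ c) (G p q)) ≡ sum (λ p → G p c)
sum₂-δʳ c G = sum-cong-≗ (λ p → sum-δ c (G p))

sum₂-opposite : ∀ {M} (G : Fin M → Fin M → ℕ) → sum₂ G ≡ sum₂ (λ p q → G (opposite q) (opposite p))
sum₂-opposite G = trans (∑-comm G) (trans (sum-involution opposite opposite-involutive (λ q → sum (λ p → G p q)))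
  (sum-cong-≗ (λ q → sum-involution opposite opposite-involutive (λ p → G p (opposite q)))))

sum₂-*-distribʳ-+ : ∀ {M} (f g h : Fin M → Fin M → ℕ) →
                    sum₂ (λ p q → (f p q + g p q) * h p q) ≡ sum₂ (λ p q → f p q * h p q) + sum₂ (λ p q → g p q * h p q)
sum₂-*-distribʳ-+ f g h = trans (sum₂-cong (λ p q → *-distribʳ-+ (h p q) (f p q) (g p q)))
  (sum₂-distrib-+ (λ p q → f p q * h p q) (λ p q → g p q * h p q))

sum₂-whenˡ-* : ∀ {M} (c : Fin M) (G h : Fin M → Fin M → ℕ) →
               sum₂ (λ p q → when (p ≟ c) (G p q) * h p q) ≡ sum (λ q → G c q * h c q)
sum₂-whenˡ-* c G h = trans (sum₂-cong (λ p q → when-* (p ≟ c) (G p q) (h p q))) (sum₂-δˡ c _)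

sum₂-whenʳ-* : ∀ {M} (c : Fin M) (G h : Fin M → Fin M → ℕ) →
               sum₂ (λ p q → when (q ≟ c) (G p q) * h p q) ≡ sum (λ p → G p c * h p c)
sum₂-whenʳ-* c G h = trans (sum₂-cong (λ p q → when-* (q ≟ c) (G p q) (h p q))) (sum₂-δʳ c _)

sum-𝟙≟-* : ∀ {M} (c : Fin M) (h : Fin M → ℕ) → sum (λ q → 𝟙 (q ≟ c) * h q) ≡ h c
sum-𝟙≟-* c h = trans (sum-cong-≗ (λ q → 𝟙-*-when (q ≟ c) (h q))) (sum-δ c h)

sum-𝟙≟+𝟙≟-* : ∀ {M} (c d : Fin M) (h : Fin M → ℕ) → sum (λ p → (𝟙 (p ≟ c) + 𝟙 (p ≟ d)) * h p) ≡ h c + h d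
sum-𝟙≟+𝟙≟-* c d h = trans (sum-cong-≗ (λ p → *-distribʳ-+ (h p) (𝟙 (p ≟ c)) (𝟙 (p ≟ d))))
  (trans (∑-distrib-+ (λ p → 𝟙 (p ≟ c) * h p) (λ p → 𝟙 (p ≟ d) * h p)) (cong₂ _+_ (sum-𝟙≟-* c h) (sum-𝟙≟-* d h)))


-- x̄ + suc x ≡ M relates the index of a letter to that of its bar among M letters, without
-- truncated subtraction.

complement-< : ∀ {M x x′ y y′} → x′ + suc x ≡ M → y′ + suc y ≡ M → x′ < y′ → y < x
complement-< {M} {x} {x′} {y} {y′} ex ey x′<y′ with x ≤? y
... | no x≰y = ≰⇒> x≰y
... | yes x≤y = ⊥-elim (n≮n M (subst₂ _<_ ex ey (+-mono-<-≤ x′<y′ (s≤s x≤y))))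

complement-sym : ∀ {M x x′} → x′ + suc x ≡ M → x + suc x′ ≡ M
complement-sym {M} {x} {x′} e = trans (+-suc x x′) (trans (cong suc (+-comm x x′)) (trans (sym (+-suc x′ x)) e))

𝟙-complement-< : ∀ {M x x′ y y′} → x′ + suc x ≡ M → y′ + suc y ≡ M → 𝟙 (x′ <? y′) ≡ 𝟙 (y <? x)
𝟙-complement-< ex ey = 𝟙-cong (_ <? _) (_ <? _) (complement-< ex ey) (complement-< (complement-sym ey) (complement-sym ex))

complement-reverses-< : ∀ {M x x̄ y ȳ} → x̄ + suc x ≡ M → ȳ + suc y ≡ M → x < y → ȳ < x̄
complement-reverses-< ex ey = complement-< (complement-sym ex) (complement-sym ey)

complement-lower : ∀ {n x x̄} → x̄ + suc x ≡ n + n → x < n → n ≤ x̄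
complement-lower {n} {x} {x̄} e x<n = +-cancelʳ-≤ (suc x) n x̄ (≤-trans (+-monoʳ-≤ n x<n) (≤-reflexive (sym e)))

complement-upper : ∀ {n x x̄} → x̄ + suc x ≡ n + n → n ≤ x → x̄ < n
complement-upper {n} {x} {x̄} e n≤x =
  +-cancelʳ-≤ n (suc x̄) n (≤-trans (≤-reflexive (sym (+-suc x̄ n))) (≤-trans (+-monoʳ-≤ x̄ (s≤s n≤x)) (≤-reflexive e)))

opposite-complement : ∀ {M} (p : Fin M) → toℕ (opposite p) + suc (toℕ p) ≡ M
opposite-complement {M} p = trans (cong (_+ suc (toℕ p)) (opposite-prop p)) (m∸n+n≡m (toℕ<n p))

opposite-injective : ∀ {M} {x y : Fin M} → opposite x ≡ opposite y → x ≡ y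
opposite-injective {x = x} {y} e = trans (sym (opposite-involutive x)) (trans (cong opposite e) (opposite-involutive y))

[<ᶠ]-opposite : ∀ {M} (p q : Fin M) → [ opposite p <ᶠ opposite q ] ≡ [ q <ᶠ p ]
[<ᶠ]-opposite p q = 𝟙-complement-< (opposite-complement p) (opposite-complement q)

[<ᶠ]-opposite-self : ∀ n (p : Fin (n + n)) → [ p <ᶠ opposite p ] ≡ 𝟙 (toℕ p <? n)
[<ᶠ]-opposite-self n p = 𝟙-cong (toℕ p <? toℕ (opposite p)) (toℕ p <? n) lower-half upper-half
  where
  lower-half : toℕ p < toℕ (opposite p) → toℕ p < n
  lower-half p<p̄ with toℕ p <? n
  ... | yes p<n = p<n
  ... | no p≮n = ⊥-elim (<-asym p<p̄ (<-≤-trans (complement-upper (opposite-complement p) (≮⇒≥ p≮n)) (≮⇒≥ p≮n)))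
  upper-half : toℕ p < n → toℕ p < toℕ (opposite p)
  upper-half p<n = <-≤-trans p<n (complement-lower (opposite-complement p) p<n)


transpose-elim : ∀ {M} {P : Fin M → Set} (a b p : Fin M) →
                 (p ≡ a → P b) → (p ≡ b → P a) → (¬ p ≡ a → ¬ p ≡ b → P p) → P (transpose a b p)
transpose-elim a b p ha hb ho with p ≟ a
... | yes e = ha e
... | no p≢a with p ≟ b
...   | yes e = hb e
...   | no p≢b = ho p≢a p≢b

transpose-matchˡ : ∀ {M} (a b : Fin M) → transpose a b a ≡ b
transpose-matchˡ a b = transpose-elim {P = _≡ b} a b a (λ _ → refl) (λ e → e) (λ a≢a _ → ⊥-elim (a≢a refl))

transpose-matchʳ : ∀ {M} (a b : Fin M) → transpose a b b ≡ a
transpose-matchʳ a b = transpose-elim {P = _≡ a} a b b (λ e → e) (λ _ → refl) (λ _ b≢b → ⊥-elim (b≢b refl))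

transpose-mismatch : ∀ {M} (a b p : Fin M) → ¬ p ≡ a → ¬ p ≡ b → transpose a b p ≡ p
transpose-mismatch a b p p≢a p≢b =
  transpose-elim {P = _≡ p} a b p (λ e → ⊥-elim (p≢a e)) (λ e → ⊥-elim (p≢b e)) (λ _ _ → refl)

transpose-involutive : ∀ {M} (a b p : Fin M) → transpose a b (transpose a b p) ≡ p
transpose-involutive a b p = transpose-elim {P = λ x → transpose a b x ≡ p} a b p
  (λ { refl → transpose-matchʳ p b }) (λ { refl → transpose-matchˡ a p }) (transpose-mismatch a b p)

transpose-comm : ∀ {M} (a b p : Fin M) → transpose a b p ≡ transpose b a p
transpose-comm a b p = transpose-elim {P = λ x → x ≡ transpose b a p} a b p
  (λ { refl → sym (transpose-matchʳ b p) }) (λ { refl → sym (transpose-matchˡ p a) })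
  (λ p≢a p≢b → sym (transpose-mismatch b a p p≢b p≢a))

transpose-opposite : ∀ {M} (a b p : Fin M) → transpose (opposite a) (opposite b) (opposite p) ≡ opposite (transpose a b p)
transpose-opposite a b p = transpose-elim {P = λ x → transpose (opposite a) (opposite b) (opposite p) ≡ opposite x} a b p
  (λ { refl → transpose-matchˡ (opposite p) (opposite b) }) (λ { refl → transpose-matchʳ (opposite a) (opposite p) })
  (λ p≢a p≢b → transpose-mismatch _ _ (opposite p) (p≢a ∘ opposite-injective) (p≢b ∘ opposite-injective))

transpose-∉ : ∀ {M} (a b p c : Fin M) → ¬ a ≡ c → ¬ b ≡ c → ¬ p ≡ c → ¬ transpose a b p ≡ c
transpose-∉ a b p c a≢c b≢c p≢c = transpose-elim {P = λ x → ¬ x ≡ c} a b p (λ _ → b≢c) (λ _ → a≢c) (λ _ _ → p≢c)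

transpose-disjoint-comm : ∀ {M} (a b c d p : Fin M) → ¬ a ≡ c → ¬ a ≡ d → ¬ b ≡ c → ¬ b ≡ d →
                          transpose a b (transpose c d p) ≡ transpose c d (transpose a b p)
transpose-disjoint-comm a b c d p a≢c a≢d b≢c b≢d =
  transpose-elim {P = λ x → transpose a b (transpose c d p) ≡ transpose c d x} a b p
    (λ { refl → trans (cong (transpose a b) (transpose-mismatch c d p a≢c a≢d))
                      (trans (transpose-matchˡ p b) (sym (transpose-mismatch c d b b≢c b≢d))) })
    (λ { refl → trans (cong (transpose a b) (transpose-mismatch c d p b≢c b≢d))
                      (trans (transpose-matchʳ a p) (sym (transpose-mismatch c d a a≢c a≢d))) })
    (λ p≢a p≢b → transpose-mismatch a b _
       (transpose-∉ c d p a (a≢c ∘ sym) (a≢d ∘ sym) p≢a) (transpose-∉ c d p b (b≢c ∘ sym) (b≢d ∘ sym) p≢b))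

transpose-preserves : ∀ {M} (h : Fin M → ℕ) (x y p : Fin M) → h x ≡ h y → h (transpose x y p) ≡ h p
transpose-preserves h x y p hx≡hy = transpose-elim {P = λ z → h z ≡ h p} x y p
  (λ { refl → sym hx≡hy }) (λ { refl → hx≡hy }) (λ _ _ → refl)

transpose-shift : ∀ {M} (h : Fin M → ℕ) (x y p : Fin M) → h y + 1 ≡ h x →
                  h (transpose x y p) + 𝟙 (p ≟ x) ≡ h p + 𝟙 (p ≟ y)
transpose-shift h x y p hy+1≡hx = transpose-elim {P = λ z → h z + 𝟙 (p ≟ x) ≡ h p + 𝟙 (p ≟ y)} x y p
  (λ { refl → trans (cong (h y +_) (𝟙-yes (p ≟ p) refl))
                    (trans hy+1≡hx (sym (trans (cong (h p +_) (𝟙-no (p ≟ y) x≢y)) (+-identityʳ (h p))))) })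
  (λ { refl → sym (trans (cong (h p +_) (𝟙-yes (p ≟ p) refl))
                    (trans hy+1≡hx (sym (trans (cong (h x +_) (𝟙-no (p ≟ x) (x≢y ∘ sym))) (+-identityʳ (h x)))))) })
  (λ p≢x p≢y → cong₂ _+_ refl (trans (𝟙-no (p ≟ x) p≢x) (sym (𝟙-no (p ≟ y) p≢y))))
  where
  x≢y : ¬ x ≡ y
  x≢y refl = n≮n (h y) (subst (h y <_) hy+1≡hx (subst (h y <_) (+-comm 1 (h y)) (n<1+n (h y))))

𝟙≟-transpose : ∀ {M} (x y p c : Fin M) → ¬ c ≡ x → ¬ c ≡ y → 𝟙 (transpose x y p ≟ c) ≡ 𝟙 (p ≟ c)
𝟙≟-transpose x y p c c≢x c≢y = 𝟙-cong (transpose x y p ≟ c) (p ≟ c)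
  (λ e → trans (sym (transpose-involutive x y p)) (trans (cong (transpose x y) e) (transpose-mismatch x y c c≢x c≢y)))
  (λ { refl → transpose-mismatch x y p c≢x c≢y })


between : ∀ {M} → Fin M → Fin M → Fin M → ℕ
between a b k = [ a <ᶠ k ] * [ k <ᶠ b ]

between-left : ∀ {M} (a b : Fin M) → between a b a ≡ 0
between-left a b = cong (_* [ a <ᶠ b ]) ([<ᶠ]-irrefl a)

between-right : ∀ {M} (a b : Fin M) → between a b b ≡ 0
between-right a b = trans (cong ([ a <ᶠ b ] *_) ([<ᶠ]-irrefl b)) (*-zeroʳ [ a <ᶠ b ])

between+[b<k] : ∀ {M} (a b k : Fin M) → toℕ a < toℕ b → ¬ k ≡ b → between a b k + [ b <ᶠ k ] ≡ [ a <ᶠ k ]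
between+[b<k] a b k a<b k≢b = go (toℕ a <? toℕ k) (toℕ k <? toℕ b) (toℕ b <? toℕ k)
  where
  go : (a<k? : Dec (toℕ a < toℕ k)) (k<b? : Dec (toℕ k < toℕ b)) (b<k? : Dec (toℕ b < toℕ k)) →
       𝟙 a<k? * 𝟙 k<b? + 𝟙 b<k? ≡ 𝟙 a<k?
  go _ (yes k<b) (yes b<k) = ⊥-elim (<-asym k<b b<k)
  go (yes _) (yes _) (no _) = refl
  go (yes _) (no _) (yes _) = refl
  go (yes _) (no k≮b) (no b≮k) = ⊥-elim (k≢b (toℕ-injective (≤-antisym (≮⇒≥ b≮k) (≮⇒≥ k≮b))))
  go (no a≮k) _ (yes b<k) = ⊥-elim (a≮k (<-trans a<b b<k))
  go (no _) _ (no _) = refl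

between+[k<a] : ∀ {M} (a b k : Fin M) → toℕ a < toℕ b → ¬ k ≡ a → between a b k + [ k <ᶠ a ] ≡ [ k <ᶠ b ]
between+[k<a] a b k a<b k≢a = go (toℕ a <? toℕ k) (toℕ k <? toℕ b) (toℕ k <? toℕ a)
  where
  go : (a<k? : Dec (toℕ a < toℕ k)) (k<b? : Dec (toℕ k < toℕ b)) (k<a? : Dec (toℕ k < toℕ a)) →
       𝟙 a<k? * 𝟙 k<b? + 𝟙 k<a? ≡ 𝟙 k<b?
  go (yes a<k) _ (yes k<a) = ⊥-elim (<-asym a<k k<a)
  go (yes _) (yes _) (no _) = refl
  go (yes _) (no _) (no _) = refl
  go (no _) (yes _) (yes _) = refl
  go (no _) (no k≮b) (yes k<a) = ⊥-elim (k≮b (<-trans k<a a<b))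
  go (no a≮k) _ (no k≮a) = ⊥-elim (k≢a (toℕ-injective (≤-antisym (≮⇒≥ a≮k) (≮⇒≥ k≮a))))

between-*-cong : ∀ {M} (a b k : Fin M) {x y : ℕ} →
                 (toℕ a < toℕ k → toℕ k < toℕ b → x ≡ y) → between a b k * x ≡ between a b k * y
between-*-cong a b k {x} {y} h = go (toℕ a <? toℕ k) (toℕ k <? toℕ b)
  where
  go : (a<k? : Dec (toℕ a < toℕ k)) (k<b? : Dec (toℕ k < toℕ b)) → 𝟙 a<k? * 𝟙 k<b? * x ≡ 𝟙 a<k? * 𝟙 k<b? * y
  go (yes a<k) (yes k<b) = cong (_+ 0) (h a<k k<b)
  go (yes _) (no _) = refl
  go (no _) _ = refl

between≡1 : ∀ {M} (a b k : Fin M) → toℕ a < toℕ k → toℕ k < toℕ b → between a b k ≡ 1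
between≡1 a b k a<k k<b = ×⇒𝟙*𝟙≡1 (toℕ a <? toℕ k) (toℕ k <? toℕ b) (a<k , k<b)

width : ∀ {M} → Fin M → Fin M → ℕ
width a b = sum (between a b)

width-+ : ∀ {M} (a b : Fin M) → toℕ a < toℕ b → width a b + suc (toℕ a) ≡ toℕ b
width-+ {M} a b a<b = begin
  width a b + suc (toℕ a)
    ≡⟨ cong (width a b +_) (sum-<-count M (suc (toℕ a)) (<-≤-trans a<b (<⇒≤ (toℕ<n b)))) ⟨
  width a b + sum {M} (λ k → 𝟙 (toℕ k <? suc (toℕ a)))
    ≡⟨ ∑-distrib-+ (between a b) (λ (k : Fin M) → 𝟙 (toℕ k <? suc (toℕ a))) ⟨
  sum {M} (λ k → between a b k + 𝟙 (toℕ k <? suc (toℕ a)))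
    ≡⟨ sum-cong-≗ (λ k → go k (toℕ a <? toℕ k) (toℕ k <? toℕ b) (toℕ k <? suc (toℕ a))) ⟩
  sum {M} (λ k → 𝟙 (toℕ k <? toℕ b))
    ≡⟨ sum-<-count M (toℕ b) (<⇒≤ (toℕ<n b)) ⟩
  toℕ b ∎
  where
  open ≡-Reasoning
  go : ∀ (k : Fin M) (a<k? : Dec (toℕ a < toℕ k)) (k<b? : Dec (toℕ k < toℕ b)) (k≤a? : Dec (toℕ k < suc (toℕ a))) →
       𝟙 a<k? * 𝟙 k<b? + 𝟙 k≤a? ≡ 𝟙 (toℕ k <? toℕ b)
  go k (yes a<k) _ (yes k≤a) = ⊥-elim (<⇒≱ a<k (≤-pred k≤a))
  go k (yes _) (yes k<b) (no _) = sym (𝟙-yes (toℕ k <? toℕ b) k<b)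
  go k (yes _) (no k≮b) (no _) = sym (𝟙-no (toℕ k <? toℕ b) k≮b)
  go k (no _) _ (yes k≤a) = sym (𝟙-yes (toℕ k <? toℕ b) (≤-<-trans (≤-pred k≤a) a<b))
  go k (no a≮k) _ (no k≰a) = ⊥-elim (a≮k (≰⇒> (k≰a ∘ s≤s)))

pointsIn : ∀ {M} → Fin M → Fin M → ℕ → ℕ → (Fin M → ℕ) → ℕ
pointsIn a b lo hi U = sum λ k → between a b k * (𝟙 (lo <? U k) * 𝟙 (U k <? hi))

pointsBetween : ∀ {M} → Fin M → Fin M → (Fin M → ℕ) → ℕ
pointsBetween a b U = pointsIn a b (U a) (U b) U

pointsIn-cong : ∀ {M} (a b : Fin M) lo hi {U V : Fin M → ℕ} →
                (∀ k → toℕ a < toℕ k → toℕ k < toℕ b → U k ≡ V k) → pointsIn a b lo hi U ≡ pointsIn a b lo hi V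
pointsIn-cong a b lo hi U≡V = sum-cong-≗ (λ k → between-*-cong a b k (λ a<k k<b → cong (λ x → 𝟙 (lo <? x) * 𝟙 (x <? hi)) (U≡V k a<k k<b)))

pointsIn-opposite : ∀ {M} (U : Fin M → ℕ) → (∀ p → U (opposite p) + suc (U p) ≡ M) → (a b : Fin M) → ∀ {lo hi lo′ hi′} →
                    lo′ + suc lo ≡ M → hi′ + suc hi ≡ M → pointsIn (opposite b) (opposite a) hi′ lo′ U ≡ pointsIn a b lo hi U
pointsIn-opposite U U-opposite a b {lo} {hi} {lo′} {hi′} lo-compl hi-compl =
  trans (sum-involution opposite opposite-involutive
    (λ k → between (opposite b) (opposite a) k * (𝟙 (hi′ <? U k) * 𝟙 (U k <? lo′)))) (sum-cong-≗ reflect)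
  where
  reflect : ∀ k → between (opposite b) (opposite a) (opposite k) * (𝟙 (hi′ <? U (opposite k)) * 𝟙 (U (opposite k) <? lo′))
                ≡ between a b k * (𝟙 (lo <? U k) * 𝟙 (U k <? hi))
  reflect k = trans (cong₂ _*_ (cong₂ _*_ ([<ᶠ]-opposite b k) ([<ᶠ]-opposite k a))
                                (cong₂ _*_ (𝟙-complement-< hi-compl (U-opposite k)) (𝟙-complement-< (U-opposite k) lo-compl)))
                    (shuffle [ k <ᶠ b ] [ a <ᶠ k ] (𝟙 (U k <? hi)) (𝟙 (lo <? U k)))
    where
    shuffle : ∀ x y z w → x * y * (z * w) ≡ y * x * (w * z)
    shuffle = solve-∀

pointsIn≤width : ∀ {M} (a b : Fin M) lo hi U → pointsIn a b lo hi U ≤ width a b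
pointsIn≤width a b lo hi U = sum-mono-≤ (λ k → between a b k * (𝟙 (lo <? U k) * 𝟙 (U k <? hi))) (between a b)
  (λ k → ≤-trans (*-monoʳ-≤ (between a b k) (𝟙*𝟙≤1 (lo <? U k) (U k <? hi)))
                                                          (≤-reflexive (*-identityʳ (between a b k))))

module _ {M} (a b : Fin M) (lo hi : ℕ) (U : Fin M → ℕ) where

  private
    InWindow : Fin M → Set
    InWindow k = lo < U k × U k < hi

    term : Fin M → ℕ
    term k = between a b k * (𝟙 (lo <? U k) * 𝟙 (U k <? hi))

    term-inside : ∀ k → toℕ a < toℕ k → toℕ k < toℕ b → term k ≡ 𝟙 (lo <? U k) * 𝟙 (U k <? hi)
    term-inside k a<k k<b = trans (cong (_* (𝟙 (lo <? U k) * 𝟙 (U k <? hi))) (between≡1 a b k a<k k<b)) (+-identityʳ _)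

  pointsIn≡0⇔ : pointsIn a b lo hi U ≡ 0 ⇔ (∀ k → toℕ a < toℕ k → toℕ k < toℕ b → ¬ InWindow k)
  pointsIn≡0⇔ = mk⇔
    (λ none k a<k k<b → 𝟙*𝟙≡0⇒¬× (lo <? U k) (U k <? hi) (trans (sym (term-inside k a<k k<b)) (sum≡0⇒ term none k)))
    (λ outside → trans (sum-cong-≗ (λ k → between-*-cong a b k (λ a<k k<b → ¬×⇒𝟙*𝟙≡0 (lo <? U k) (U k <? hi) (outside k a<k k<b))))
                       (sum-zero _ (λ k → *-zeroʳ (between a b k))))

  pointsIn≡width⇔ : pointsIn a b lo hi U ≡ width a b ⇔ (∀ k → toℕ a < toℕ k → toℕ k < toℕ b → InWindow k)
  pointsIn≡width⇔ = mk⇔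
    (λ all k a<k k<b → 𝟙*𝟙≡1⇒× (lo <? U k) (U k <? hi)
       (trans (sym (term-inside k a<k k<b)) (trans (term≡between all k) (between≡1 a b k a<k k<b))))
    (λ inside → trans (sum-cong-≗ (λ k → between-*-cong a b k (λ a<k k<b → ×⇒𝟙*𝟙≡1 (lo <? U k) (U k <? hi) (inside k a<k k<b))))
                      (sum-cong-≗ (λ k → *-identityʳ (between a b k))))
    where
    term≤between : ∀ k → term k ≤ between a b k
    term≤between k = ≤-trans (*-monoʳ-≤ (between a b k) (𝟙*𝟙≤1 (lo <? U k) (U k <? hi))) (≤-reflexive (*-identityʳ (between a b k)))
    term≡between : pointsIn a b lo hi U ≡ width a b → ∀ k → term k ≡ between a b k
    term≡between = sum-≤-≡⇒≗ term (between a b) term≤between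


-- Inversions

inversions : ∀ {M} → (Fin M → ℕ) → ℕ
inversions U = sum₂ λ p q → [ p <ᶠ q ] * 𝟙 (U q <? U p)

module _ {M} {a b : Fin M} (a<b : toℕ a < toℕ b) {t : Fin M → Fin M}
         (t-a : t a ≡ b) (t-b : t b ≡ a) (t-other : ∀ p → ¬ p ≡ a → ¬ p ≡ b → t p ≡ p) where

  private
    corner : between a b b + (between a b a + suc [ b <ᶠ a ]) ≡ [ a <ᶠ b ]
    corner = trans (cong₂ (λ x y → x + (y + suc [ b <ᶠ a ])) (between-right a b) (between-left a b))
                   (trans (cong suc (𝟙-no (toℕ b <? toℕ a) (<⇒≯ a<b))) (sym (𝟙-yes (toℕ a <? toℕ b) a<b)))

  [<ᶠ]-transposed : ∀ p q →
    when (p ≟ a) (between a b q) + (when (q ≟ b) (between a b p) + (when (p ≟ a) (𝟙 (q ≟ b)) + [ t p <ᶠ t q ]))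
    ≡ when (q ≟ a) (between a b p) + (when (p ≟ b) (between a b q) + (when (p ≟ b) (𝟙 (q ≟ a)) + [ p <ᶠ q ]))
  [<ᶠ]-transposed p q with p ≟ a | p ≟ b | q ≟ a | q ≟ b
  ... | yes refl | yes refl | _ | _ = ⊥-elim (n≮n _ a<b)
  ... | _ | _ | yes refl | yes refl = ⊥-elim (n≮n _ a<b)
  ... | yes refl | no _ | yes refl | no _ = cong (between a b a +_) (trans ([<ᶠ]-irrefl (t a)) (sym ([<ᶠ]-irrefl a)))
  ... | yes refl | no _ | no _ | yes refl rewrite t-a | t-b = corner
  ... | yes refl | no _ | no q≢a | no q≢b rewrite t-a | t-other q q≢a q≢b = between+[b<k] a b q a<b q≢b
  ... | no _ | yes refl | yes refl | no _ rewrite t-a | t-b = sym corner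
  ... | no _ | yes refl | no _ | yes refl = cong (between a b b +_) (trans ([<ᶠ]-irrefl (t b)) (sym ([<ᶠ]-irrefl b)))
  ... | no _ | yes refl | no q≢a | no q≢b rewrite t-b | t-other q q≢a q≢b = sym (between+[b<k] a b q a<b q≢b)
  ... | no p≢a | no p≢b | yes refl | no _ rewrite t-a | t-other p p≢a p≢b = sym (between+[k<a] a b p a<b p≢a)
  ... | no p≢a | no p≢b | no _ | yes refl rewrite t-b | t-other p p≢a p≢b = between+[k<a] a b p a<b p≢a
  ... | no p≢a | no p≢b | no q≢a | no q≢b rewrite t-other p p≢a p≢b | t-other q q≢a q≢b = refl

-- Only pairs involving a or b change: the pair (a, b) itself, and for each k strictly between them
-- the two pairs (a, k), (k, b), which change by 2 in total exactly when U a < U k < U b.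
module _ {M} (U : Fin M → ℕ) (U-injective : ∀ {x y} → U x ≡ U y → x ≡ y)
         {a b : Fin M} (a<b : toℕ a < toℕ b) (Ua<Ub : U a < U b) where

  private
    t = transpose a b
    V : Fin M → Fin M → ℕ
    V p q = 𝟙 (U q <? U p)
    P₁ P₂ Q₁ Q₂ : ℕ
    P₁ = sum λ k → between a b k * 𝟙 (U k <? U a)
    P₂ = sum λ k → between a b k * 𝟙 (U b <? U k)
    Q₁ = sum λ k → between a b k * 𝟙 (U a <? U k)
    Q₂ = sum λ k → between a b k * 𝟙 (U k <? U b)
    C = pointsBetween a b U

    reindexed : inversions (U ∘ t) ≡ sum₂ (λ p q → [ t p <ᶠ t q ] * V p q)
    reindexed = trans (sum-involution t (transpose-involutive a b) _)
      (sum-cong-≗ (λ p → trans (sum-involution t (transpose-involutive a b) _)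
        (sum-cong-≗ (λ q → cong₂ (λ x y → [ t p <ᶠ t q ] * 𝟙 (U x <? U y)) (transpose-involutive a b q) (transpose-involutive a b p)))))

    expand : (c₁ c₂ c₃ c₄ : Fin M → Fin M → ℕ) →
             sum₂ (λ p q → (c₁ p q + (c₂ p q + (c₃ p q + c₄ p q))) * V p q)
             ≡ sum₂ (λ p q → c₁ p q * V p q) + (sum₂ (λ p q → c₂ p q * V p q)
               + (sum₂ (λ p q → c₃ p q * V p q) + sum₂ (λ p q → c₄ p q * V p q)))
    expand c₁ c₂ c₃ c₄ = trans (sum₂-*-distribʳ-+ c₁ _ V)
      (cong (_ +_) (trans (sum₂-*-distribʳ-+ c₂ _ V) (cong (_ +_) (sum₂-*-distribʳ-+ c₃ c₄ V))))

    weighted : P₁ + (P₂ + (V a b + sum₂ (λ p q → [ t p <ᶠ t q ] * V p q))) ≡ Q₁ + (Q₂ + (V b a + inversions U))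
    weighted = begin
      P₁ + (P₂ + (V a b + sum₂ (λ p q → [ t p <ᶠ t q ] * V p q)))
        ≡⟨ expand-at a b (λ p q → [ t p <ᶠ t q ]) ⟨
      sum₂ (λ p q → (when (p ≟ a) (between a b q) + (when (q ≟ b) (between a b p)
                    + (when (p ≟ a) (𝟙 (q ≟ b)) + [ t p <ᶠ t q ]))) * V p q)
        ≡⟨ sum₂-cong (λ p q → cong (_* V p q) ([<ᶠ]-transposed a<b (transpose-matchˡ a b) (transpose-matchʳ a b) (transpose-mismatch a b) p q)) ⟩
      sum₂ (λ p q → (when (q ≟ a) (between a b p) + (when (p ≟ b) (between a b q)
                    + (when (p ≟ b) (𝟙 (q ≟ a)) + [ p <ᶠ q ]))) * V p q)
        ≡⟨ expand-at′ ⟩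
      Q₁ + (Q₂ + (V b a + inversions U)) ∎
      where
      open ≡-Reasoning
      expand-at : ∀ c d (f : Fin M → Fin M → ℕ) →
                  sum₂ (λ p q → (when (p ≟ c) (between a b q) + (when (q ≟ d) (between a b p)
                                + (when (p ≟ c) (𝟙 (q ≟ d)) + f p q))) * V p q)
                  ≡ sum (λ q → between a b q * V c q) + (sum (λ p → between a b p * V p d) + (V c d + sum₂ (λ p q → f p q * V p q)))
      expand-at c d f = trans
        (expand (λ p q → when (p ≟ c) (between a b q)) (λ p q → when (q ≟ d) (between a b p)) (λ p q → when (p ≟ c) (𝟙 (q ≟ d))) f)
        (cong₂ _+_ (sum₂-whenˡ-* c (λ _ q → between a b q) V)
        (cong₂ _+_ (sum₂-whenʳ-* d (λ p _ → between a b p) V)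
          (cong (_+ _) (trans (sum₂-whenˡ-* c (λ _ q → 𝟙 (q ≟ d)) V) (sum-𝟙≟-* d (V c))))))
      expand-at′ : sum₂ (λ p q → (when (q ≟ a) (between a b p) + (when (p ≟ b) (between a b q)
                                 + (when (p ≟ b) (𝟙 (q ≟ a)) + [ p <ᶠ q ]))) * V p q)
                   ≡ Q₁ + (Q₂ + (V b a + inversions U))
      expand-at′ = trans
        (expand (λ p q → when (q ≟ a) (between a b p)) (λ p q → when (p ≟ b) (between a b q)) (λ p q → when (p ≟ b) (𝟙 (q ≟ a)))
                (λ p q → [ p <ᶠ q ]))
        (cong₂ _+_ (sum₂-whenʳ-* a (λ p _ → between a b p) V)
        (cong₂ _+_ (sum₂-whenˡ-* b (λ _ q → between a b q) V)
          (cong (_+ _) (trans (sum₂-whenˡ-* b (λ _ q → 𝟙 (q ≟ a)) V) (sum-𝟙≟-* a (V b))))))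

    window : P₁ + P₂ + 2 * C ≡ Q₁ + Q₂
    window = begin
      P₁ + P₂ + 2 * C
        ≡⟨ cong (P₁ + P₂ +_) (*-distribˡ-sum 2 λ k → between a b k * (𝟙 (U a <? U k) * 𝟙 (U k <? U b))) ⟩
      P₁ + P₂ + sum (λ k → 2 * (between a b k * (𝟙 (U a <? U k) * 𝟙 (U k <? U b))))
        ≡⟨ cong (_+ sum (λ k → 2 * (between a b k * (𝟙 (U a <? U k) * 𝟙 (U k <? U b)))))
             (∑-distrib-+ (λ k → between a b k * 𝟙 (U k <? U a)) (λ k → between a b k * 𝟙 (U b <? U k))) ⟨
      sum (λ k → between a b k * 𝟙 (U k <? U a) + between a b k * 𝟙 (U b <? U k))
        + sum (λ k → 2 * (between a b k * (𝟙 (U a <? U k) * 𝟙 (U k <? U b))))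
        ≡⟨ ∑-distrib-+ (λ k → between a b k * 𝟙 (U k <? U a) + between a b k * 𝟙 (U b <? U k)) _ ⟨
      sum (λ k → between a b k * 𝟙 (U k <? U a) + between a b k * 𝟙 (U b <? U k)
                 + 2 * (between a b k * (𝟙 (U a <? U k) * 𝟙 (U k <? U b))))
        ≡⟨ sum-cong-≗ pointwise ⟩
      sum (λ k → between a b k * 𝟙 (U a <? U k) + between a b k * 𝟙 (U k <? U b))
        ≡⟨ ∑-distrib-+ (λ k → between a b k * 𝟙 (U a <? U k)) (λ k → between a b k * 𝟙 (U k <? U b)) ⟩
      Q₁ + Q₂ ∎
      where
      open ≡-Reasoning
      factor : ∀ β x y z → β * x + β * y + 2 * (β * z) ≡ β * (x + y + 2 * z)
      factor = solve-∀
      pointwise : ∀ k → between a b k * 𝟙 (U k <? U a) + between a b k * 𝟙 (U b <? U k)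
                        + 2 * (between a b k * (𝟙 (U a <? U k) * 𝟙 (U k <? U b)))
                      ≡ between a b k * 𝟙 (U a <? U k) + between a b k * 𝟙 (U k <? U b)
      pointwise k = trans (factor (between a b k) (𝟙 (U k <? U a)) (𝟙 (U b <? U k)) (𝟙 (U a <? U k) * 𝟙 (U k <? U b))) (trans
        (between-*-cong a b k (λ a<k k<b → 𝟙-window Ua<Ub
            (λ e → n≮n (toℕ a) (subst (λ x → toℕ a < toℕ x) (U-injective e) a<k))
            (λ e → n≮n (toℕ b) (subst (λ x → toℕ x < toℕ b) (U-injective e) k<b))))
        (*-distribˡ-+ (between a b k) (𝟙 (U a <? U k)) (𝟙 (U k <? U b))))

  inversions-transpose : inversions (U ∘ transpose a b) ≡ inversions U + suc (2 * C)
  inversions-transpose = +-cancelˡ-≡ (P₁ + P₂) _ _ (begin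
    P₁ + P₂ + inversions (U ∘ t)        ≡⟨ cong (P₁ + P₂ +_) reindexed ⟩
    P₁ + P₂ + sum₂ (λ p q → [ t p <ᶠ t q ] * V p q)
      ≡⟨ +-assoc P₁ P₂ _ ⟩
    P₁ + (P₂ + sum₂ (λ p q → [ t p <ᶠ t q ] * V p q))
      ≡⟨ cong (λ x → P₁ + (P₂ + (x + sum₂ (λ p q → [ t p <ᶠ t q ] * V p q)))) (𝟙-no (U b <? U a) (<⇒≯ Ua<Ub)) ⟨
    P₁ + (P₂ + (V a b + sum₂ (λ p q → [ t p <ᶠ t q ] * V p q)))             ≡⟨ weighted ⟩
    Q₁ + (Q₂ + (V b a + inversions U))  ≡⟨ cong (λ x → Q₁ + (Q₂ + (x + inversions U))) (𝟙-yes (U a <? U b) Ua<Ub) ⟩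
    Q₁ + (Q₂ + suc (inversions U))      ≡⟨ sym (+-assoc Q₁ Q₂ _) ⟩
    Q₁ + Q₂ + suc (inversions U)        ≡⟨ cong (_+ suc (inversions U)) window ⟨
    P₁ + P₂ + 2 * C + suc (inversions U) ≡⟨ rearrange (P₁ + P₂) (2 * C) (inversions U) ⟩
    P₁ + P₂ + (inversions U + suc (2 * C)) ∎)
    where
    open ≡-Reasoning
    rearrange : ∀ x c i → x + c + suc i ≡ x + (i + suc c)
    rearrange = solve-∀

inversions-transpose² : ∀ {M} (U : Fin M → ℕ) → (∀ {x y} → U x ≡ U y → x ≡ y) → {a c d e : Fin M} →
  toℕ a < toℕ c → U a < U c → toℕ d < toℕ e → U d < U e → ¬ d ≡ a → ¬ d ≡ c → ¬ e ≡ a → ¬ e ≡ c →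
  inversions (λ p → U (transpose a c (transpose d e p)))
  ≡ inversions U + suc (2 * pointsBetween a c U) + suc (2 * pointsBetween d e (U ∘ transpose a c))
inversions-transpose² U U-injective {a} {c} {d} {e} a<c Ua<Uc d<e Ud<Ue d≢a d≢c e≢a e≢c =
  trans (inversions-transpose (U ∘ transpose a c) U₁-injective d<e U₁d<U₁e)
        (cong (_+ suc (2 * pointsBetween d e (U ∘ transpose a c))) (inversions-transpose U U-injective a<c Ua<Uc))
  where
  U₁-injective : ∀ {x y} → U (transpose a c x) ≡ U (transpose a c y) → x ≡ y
  U₁-injective {x} {y} eq = trans (sym (transpose-involutive a c x)) (trans (cong (transpose a c) (U-injective eq)) (transpose-involutive a c y))
  U₁d<U₁e : U (transpose a c d) < U (transpose a c e)
  U₁d<U₁e = subst₂ (λ x y → U x < U y) (sym (transpose-mismatch a c d d≢a d≢c)) (sym (transpose-mismatch a c e e≢a e≢c)) Ud<Ue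


-- The length function

absIdx-lower : ∀ {n} (q : Fin (n + n)) → toℕ q < n → absIdx {n} ⟨ q ⟩ ≡ toℕ q
absIdx-lower {n} q q<n = cong (λ b → if b then toℕ q else toℕ (opposite q)) (dec-true (toℕ q <? n) q<n)

absIdx-upper : ∀ {n} (q : Fin (n + n)) → n ≤ toℕ q → absIdx {n} ⟨ q ⟩ ≡ toℕ (opposite q)
absIdx-upper {n} q n≤q = cong (λ b → if b then toℕ q else toℕ (opposite q)) (dec-false (toℕ q <? n) (≤⇒≯ n≤q))

-- Defs.len with letters replaced by their indices: U l is the index of w(l).
lenℕ : ∀ n → (Fin (n + n) → ℕ) → ℕ
lenℕ n U = sum {n} λ k → sum λ l → 𝟙 (toℕ k ≤? absIdx {n} ⟨ l ⟩) * 𝟙 (U l <? U (k ↑ˡ n))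

negatives : ∀ {M} → (Fin M → ℕ) → ℕ
negatives U = sum λ p → [ p <ᶠ opposite p ] * 𝟙 (U (opposite p) <? U p)

-- Inversions (p, q) are split by p ≤ q̄, the ones counted by ℓ, against p > q̄; the latter mirror
-- those with p < q̄ under (p, q) ↦ (q̄, p̄), and those with p = q̄ are the barred values.
module _ (n : ℕ) (U : Fin (n + n) → ℕ) (U-opposite : ∀ p → U (opposite p) + suc (U p) ≡ n + n) where

  private
    F : Fin (n + n) → Fin (n + n) → ℕ
    F p q = [ p <ᶠ q ] * 𝟙 (U q <? U p)

    within strictlyWithin beyond : ℕ
    within = sum₂ λ p q → F p q * 𝟙 (toℕ p ≤? toℕ (opposite q))
    strictlyWithin = sum₂ λ p q → F p q * [ p <ᶠ opposite q ]
    beyond = sum₂ λ p q → F p q * [ opposite q <ᶠ p ]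

    inversions≡within+beyond : inversions U ≡ within + beyond
    inversions≡within+beyond = trans (sum₂-cong split)
      (sum₂-distrib-+ (λ p q → F p q * 𝟙 (toℕ p ≤? toℕ (opposite q))) (λ p q → F p q * [ opposite q <ᶠ p ]))
      where
      split : ∀ p q → F p q ≡ F p q * 𝟙 (toℕ p ≤? toℕ (opposite q)) + F p q * [ opposite q <ᶠ p ]
      split p q = trans (sym (*-identityʳ (F p q)))
        (trans (cong (F p q *_) (sym (𝟙-≤+> (toℕ p) (toℕ (opposite q))))) (*-distribˡ-+ (F p q) _ _))

    beyond≡strictlyWithin : beyond ≡ strictlyWithin
    beyond≡strictlyWithin = trans (sum₂-opposite (λ p q → F p q * [ opposite q <ᶠ p ])) (sum₂-cong reflect)
      where
      reflect : ∀ p q → F (opposite q) (opposite p) * [ opposite (opposite p) <ᶠ opposite q ] ≡ F p q * [ p <ᶠ opposite q ]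
      reflect p q = cong₂ _*_ (cong₂ _*_ ([<ᶠ]-opposite q p) (𝟙-complement-< (U-opposite p) (U-opposite q)))
                              (cong (λ x → [ x <ᶠ opposite q ]) (opposite-involutive p))

    within≡strictlyWithin+negatives : within ≡ strictlyWithin + negatives U
    within≡strictlyWithin+negatives = trans (sum₂-cong split)
      (trans (sum₂-distrib-+ (λ p q → F p q * [ p <ᶠ opposite q ]) (λ p q → F p q * 𝟙 (toℕ p ≟ℕ toℕ (opposite q))))
             (cong (strictlyWithin +_) diagonal))
      where
      split : ∀ p q → F p q * 𝟙 (toℕ p ≤? toℕ (opposite q)) ≡ F p q * [ p <ᶠ opposite q ] + F p q * 𝟙 (toℕ p ≟ℕ toℕ (opposite q))
      split p q = trans (cong (F p q *_) (𝟙-≤-split (toℕ p) (toℕ (opposite q)))) (*-distribˡ-+ (F p q) _ _)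
      on-diagonal : ∀ p q → F p q * 𝟙 (toℕ p ≟ℕ toℕ (opposite q)) ≡ when (q ≟ opposite p) (F p (opposite p))
      on-diagonal p q with q ≟ opposite p
      ... | yes refl = trans (cong (F p (opposite p) *_) (𝟙-yes (toℕ p ≟ℕ _) (cong toℕ (sym (opposite-involutive p)))))
                             (*-identityʳ (F p (opposite p)))
      ... | no q≢p̄ = trans (cong (F p q *_) (𝟙-no (toℕ p ≟ℕ toℕ (opposite q))
                             (λ e → q≢p̄ (trans (sym (opposite-involutive q)) (cong opposite (sym (toℕ-injective e)))))))
                           (*-zeroʳ (F p q))
      diagonal : sum₂ (λ p q → F p q * 𝟙 (toℕ p ≟ℕ toℕ (opposite q))) ≡ negatives U
      diagonal = trans (sum₂-cong on-diagonal) (sum-cong-≗ (λ p → sum-δ (opposite p) (λ _ → F p (opposite p))))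

    upper-half-outside : ∀ (p q : Fin (n + n)) → n ≤ toℕ p → [ p <ᶠ q ] * 𝟙 (toℕ p ≤? toℕ (opposite q)) ≡ 0
    upper-half-outside p q n≤p = go (toℕ p <? toℕ q) (toℕ p ≤? toℕ (opposite q))
      where
      go : (p<q? : Dec (toℕ p < toℕ q)) (p≤q̄? : Dec (toℕ p ≤ toℕ (opposite q))) → 𝟙 p<q? * 𝟙 p≤q̄? ≡ 0
      go (yes p<q) (yes p≤q̄) = ⊥-elim (n≮n (n + n) (begin-strict
        n + n                           ≤⟨ +-mono-≤ n≤p n≤p ⟩
        toℕ p + toℕ p                   <⟨ +-monoʳ-< (toℕ p) p<q ⟩
        toℕ p + toℕ q                   ≤⟨ +-monoˡ-≤ (toℕ q) p≤q̄ ⟩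
        toℕ (opposite q) + toℕ q        <⟨ +-monoʳ-< (toℕ (opposite q)) (n<1+n (toℕ q)) ⟩
        toℕ (opposite q) + suc (toℕ q)  ≡⟨ opposite-complement q ⟩
        n + n                           ∎))
        where open ≤-Reasoning
      go (yes _) (no _) = refl
      go (no _) _ = refl

    lower-term-unbarred : ∀ (k : Fin n) q → toℕ q < n → 𝟙 (toℕ k ≤? absIdx {n} ⟨ q ⟩) * 𝟙 (U q <? U (k ↑ˡ n))
                          ≡ F (k ↑ˡ n) q * 𝟙 (toℕ (k ↑ˡ n) ≤? toℕ (opposite q))
    lower-term-unbarred k q q<n = begin
      𝟙 (toℕ k ≤? absIdx {n} ⟨ q ⟩) * V  ≡⟨ cong (λ x → 𝟙 (toℕ k ≤? x) * V) (absIdx-lower q q<n) ⟩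
      𝟙 (toℕ k ≤? toℕ q) * V            ≡⟨ same-half (<-cmp (toℕ k) (toℕ q)) ⟩
      [ p <ᶠ q ] * V                    ≡⟨ *-identityʳ _ ⟨
      [ p <ᶠ q ] * V * 1                ≡⟨ cong (F p q *_) (𝟙-yes (toℕ p ≤? toℕ (opposite q)) p≤q̄) ⟨
      F p q * 𝟙 (toℕ p ≤? toℕ (opposite q)) ∎
      where
      open ≡-Reasoning
      p = k ↑ˡ n
      V = 𝟙 (U q <? U p)
      p≡k : toℕ p ≡ toℕ k
      p≡k = toℕ-↑ˡ k n
      p≤q̄ : toℕ p ≤ toℕ (opposite q)
      p≤q̄ = <⇒≤ (subst (_< toℕ (opposite q)) (sym p≡k) (<-≤-trans (toℕ<n k) (complement-lower (opposite-complement q) q<n)))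
      same-half : Tri (toℕ k < toℕ q) (toℕ k ≡ toℕ q) (toℕ q < toℕ k) → 𝟙 (toℕ k ≤? toℕ q) * V ≡ [ p <ᶠ q ] * V
      same-half (tri< k<q _ _) = cong (_* V) (trans (𝟙-yes (toℕ k ≤? toℕ q) (<⇒≤ k<q))
                                                    (sym (𝟙-yes (toℕ p <? toℕ q) (subst (_< toℕ q) (sym p≡k) k<q))))
      same-half (tri≈ _ k≡q _) = trans (cong (𝟙 (toℕ k ≤? toℕ q) *_) V≡0)
        (trans (*-zeroʳ (𝟙 (toℕ k ≤? toℕ q))) (sym (trans (cong ([ p <ᶠ q ] *_) V≡0) (*-zeroʳ [ p <ᶠ q ]))))
        where
        V≡0 : V ≡ 0
        V≡0 = 𝟙-no (U q <? U p) (λ lt → n≮n (U q) (subst (λ x → U q < U x) (toℕ-injective (trans p≡k k≡q)) lt))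
      same-half (tri> _ _ q<k) = cong (_* V) (trans (𝟙-no (toℕ k ≤? toℕ q) (<⇒≱ q<k))
                                                    (sym (𝟙-no (toℕ p <? toℕ q) (λ p<q → <⇒≱ q<k (<⇒≤ (subst (_< toℕ q) p≡k p<q))))))

    lower-term-barred : ∀ (k : Fin n) q → n ≤ toℕ q → 𝟙 (toℕ k ≤? absIdx {n} ⟨ q ⟩) * 𝟙 (U q <? U (k ↑ˡ n))
                        ≡ F (k ↑ˡ n) q * 𝟙 (toℕ (k ↑ˡ n) ≤? toℕ (opposite q))
    lower-term-barred k q n≤q = begin
      𝟙 (toℕ k ≤? absIdx {n} ⟨ q ⟩) * V  ≡⟨ cong (λ x → 𝟙 (toℕ k ≤? x) * V) (absIdx-upper q n≤q) ⟩
      𝟙 (toℕ k ≤? toℕ (opposite q)) * V ≡⟨ *-comm _ V ⟩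
      V * 𝟙 (toℕ k ≤? toℕ (opposite q)) ≡⟨ cong (λ x → V * 𝟙 (x ≤? toℕ (opposite q))) (toℕ-↑ˡ k n) ⟨
      V * 𝟙 (toℕ p ≤? toℕ (opposite q)) ≡⟨ cong (_* 𝟙 (toℕ p ≤? toℕ (opposite q))) (*-identityˡ V) ⟨
      1 * V * 𝟙 (toℕ p ≤? toℕ (opposite q))
        ≡⟨ cong (λ x → x * V * 𝟙 (toℕ p ≤? toℕ (opposite q))) (𝟙-yes (toℕ p <? toℕ q) p<q) ⟨
      F p q * 𝟙 (toℕ p ≤? toℕ (opposite q)) ∎
      where
      open ≡-Reasoning
      p = k ↑ˡ n
      V = 𝟙 (U q <? U p)
      p<q : toℕ p < toℕ q
      p<q = subst (_< toℕ q) (sym (toℕ-↑ˡ k n)) (<-≤-trans (toℕ<n k) n≤q)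

    lower-half-term : ∀ (k : Fin n) q → 𝟙 (toℕ k ≤? absIdx {n} ⟨ q ⟩) * 𝟙 (U q <? U (k ↑ˡ n))
                                        ≡ F (k ↑ˡ n) q * 𝟙 (toℕ (k ↑ˡ n) ≤? toℕ (opposite q))
    lower-half-term k q with toℕ q <? n
    ... | yes q<n = lower-term-unbarred k q q<n
    ... | no q≮n = lower-term-barred k q (≮⇒≥ q≮n)

    lenℕ≡within : lenℕ n U ≡ within
    lenℕ≡within = sym (begin
      within ≡⟨ sum-↑ n n _ ⟩
      sum (λ k → sum (λ q → F (k ↑ˡ n) q * 𝟙 (toℕ (k ↑ˡ n) ≤? toℕ (opposite q))))
        + sum (λ k → sum (λ q → F (n ↑ʳ k) q * 𝟙 (toℕ (n ↑ʳ k) ≤? toℕ (opposite q))))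
        ≡⟨ cong (lower +_) (sum-zero {n} _ (λ k → sum-zero {n + n} _ (λ q → upper-term k q))) ⟩
      lower + 0 ≡⟨ +-identityʳ lower ⟩
      lower ≡⟨ sum-cong-≗ (λ k → sum-cong-≗ (λ q → sym (lower-half-term k q))) ⟩
      lenℕ n U ∎)
      where
      open ≡-Reasoning
      lower = sum (λ k → sum (λ q → F (k ↑ˡ n) q * 𝟙 (toℕ (k ↑ˡ n) ≤? toℕ (opposite q))))
      upper-term : ∀ k q → F (n ↑ʳ k) q * 𝟙 (toℕ (n ↑ʳ k) ≤? toℕ (opposite q)) ≡ 0
      upper-term k q = trans (rearrange ([ n ↑ʳ k <ᶠ q ]) _ _)
        (cong (_* 𝟙 (U q <? U (n ↑ʳ k))) (upper-half-outside (n ↑ʳ k) q (subst (n ≤_) (sym (toℕ-↑ʳ n k)) (m≤m+n n (toℕ k)))))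
        where
        rearrange : ∀ x v w → x * v * w ≡ x * w * v
        rearrange = solve-∀

  2*lenℕ≡inversions+negatives : 2 * lenℕ n U ≡ inversions U + negatives U
  2*lenℕ≡inversions+negatives = begin
    2 * lenℕ n U                           ≡⟨ cong (2 *_) lenℕ≡within ⟩
    2 * within                             ≡⟨ cong (within +_) (+-identityʳ within) ⟩
    within + within                        ≡⟨ cong (within +_) within≡strictlyWithin+negatives ⟩
    within + (strictlyWithin + negatives U) ≡⟨ sym (+-assoc within _ _) ⟩
    within + strictlyWithin + negatives U  ≡⟨ cong (λ x → within + x + negatives U) beyond≡strictlyWithin ⟨
    within + beyond + negatives U          ≡⟨ cong (_+ negatives U) inversions≡within+beyond ⟨
    inversions U + negatives U ∎
    where open ≡-Reasoning

lenℕ-cong : ∀ n {U V : Fin (n + n) → ℕ} → (∀ l → U l ≡ V l) → lenℕ n U ≡ lenℕ n V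
lenℕ-cong n U≗V = sum-cong-≗ (λ k → sum-cong-≗ (λ l →
  cong₂ (λ x y → 𝟙 (toℕ k ≤? absIdx {n} ⟨ l ⟩) * 𝟙 (x <? y)) (U≗V l) (U≗V (k ↑ˡ n))))


record IsSigned (n : ℕ) (U : Fin (n + n) → ℕ) : Set where
  field
    complement : ∀ p → U (opposite p) + suc (U p) ≡ n + n
    injective  : ∀ {x y} → U x ≡ U y → x ≡ y

record IsSignedInvolution {M} (T : Fin M → Fin M) : Set where
  field
    involutive    : ∀ p → T (T p) ≡ p
    opposite-comm : ∀ p → T (opposite p) ≡ opposite (T p)

IsSigned-∘ : ∀ {n U T} → IsSigned n U → IsSignedInvolution T → IsSigned n (U ∘ T)
IsSigned-∘ {U = U} {T} sU sT = record
  { complement = λ p → trans (cong (λ x → U x + suc (U (T p))) (opposite-comm p)) (complement (T p))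
  ; injective  = λ {x} {y} e → trans (sym (involutive x)) (trans (cong T (injective e)) (involutive y))
  }
  where
  open IsSigned sU
  open IsSignedInvolution sT

IsSigned-< : ∀ {n U} → IsSigned n U → ∀ p → U p < n + n
IsSigned-< {n} {U} sU p = subst (U p <_) (IsSigned.complement sU p) (≤-trans (n<1+n (U p)) (m≤n+m (suc (U p)) (U (opposite p))))

IsSignedInvolution-≗ : ∀ {M} {T T′ : Fin M → Fin M} → (∀ p → T p ≡ T′ p) → IsSignedInvolution T → IsSignedInvolution T′
IsSignedInvolution-≗ {T = T} {T′} T≗T′ sT = record
  { involutive    = λ p → trans (sym (T≗T′ (T′ p))) (trans (cong T (sym (T≗T′ p))) (involutive p))
  ; opposite-comm = λ p → trans (sym (T≗T′ (opposite p))) (trans (opposite-comm p) (cong opposite (T≗T′ p)))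
  }
  where open IsSignedInvolution sT

transpose-self-opposite : ∀ {M} (a : Fin M) → IsSignedInvolution (transpose a (opposite a))
transpose-self-opposite a = record
  { involutive    = transpose-involutive a (opposite a)
  ; opposite-comm = λ p → trans (transpose-comm a (opposite a) (opposite p))
      (trans (cong (λ x → transpose (opposite a) x (opposite p)) (sym (opposite-involutive a))) (transpose-opposite a (opposite a) p))
  }

pairedTranspose : ∀ {M} → Fin M → Fin M → Fin M → Fin M
pairedTranspose a c p = transpose a c (transpose (opposite c) (opposite a) p)

module _ {M} {a c : Fin M} (a≢c̄ : ¬ a ≡ opposite c) (a≢ā : ¬ a ≡ opposite a) (c≢c̄ : ¬ c ≡ opposite c) (c≢ā : ¬ c ≡ opposite a) where

  pairedTranspose-comm : ∀ p → pairedTranspose a c p ≡ transpose (opposite c) (opposite a) (transpose a c p)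
  pairedTranspose-comm p = transpose-disjoint-comm a c (opposite c) (opposite a) p a≢c̄ a≢ā c≢c̄ c≢ā

  pairedTranspose-signed : IsSignedInvolution (pairedTranspose a c)
  pairedTranspose-signed = record
    { involutive    = λ p → trans (cong (transpose a c) (sym (pairedTranspose-comm (transpose (opposite c) (opposite a) p))))
                                  (trans (transpose-involutive a c _) (transpose-involutive (opposite c) (opposite a) p))
    ; opposite-comm = λ p → begin
        transpose a c (transpose (opposite c) (opposite a) (opposite p))
          ≡⟨ cong (transpose a c) (transpose-opposite c a p) ⟩
        transpose a c (opposite (transpose c a p))
          ≡⟨ cong₂ (λ x y → transpose x y (opposite (transpose c a p))) (opposite-involutive a) (opposite-involutive c) ⟨
        transpose (opposite (opposite a)) (opposite (opposite c)) (opposite (transpose c a p))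
          ≡⟨ transpose-opposite (opposite a) (opposite c) (transpose c a p) ⟩
        opposite (transpose (opposite a) (opposite c) (transpose c a p))
          ≡⟨ cong opposite (trans (transpose-comm (opposite a) (opposite c) (transpose c a p))
                                  (cong (transpose (opposite c) (opposite a)) (transpose-comm c a p))) ⟩
        opposite (transpose (opposite c) (opposite a) (transpose a c p))
          ≡⟨ cong opposite (pairedTranspose-comm p) ⟨
        opposite (pairedTranspose a c p) ∎
    }
    where open ≡-Reasoning

barredAt : ∀ {M} → (Fin M → ℕ) → Fin M → ℕ
barredAt B p = 𝟙 (B (opposite p) <? B p)

barredAt-< : ∀ {M} (B : Fin M → ℕ) {p} → B p < B (opposite p) → barredAt B p ≡ 0 × barredAt B (opposite p) ≡ 1
barredAt-< B {p} lt = 𝟙-no (B (opposite p) <? B p) (<⇒≯ lt)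
                    , 𝟙-yes (B (opposite (opposite p)) <? B (opposite p)) (subst (λ x → B x < B (opposite p)) (sym (opposite-involutive p)) lt)

negatives-∘ : ∀ {M} (B : Fin M → ℕ) {T : Fin M → Fin M} → IsSignedInvolution T → (D E : Fin M → ℕ) →
              (∀ p → [ T p <ᶠ opposite (T p) ] + D p ≡ [ p <ᶠ opposite p ] + E p) →
              negatives (B ∘ T) + sum (λ p → D p * barredAt B p) ≡ negatives B + sum (λ p → E p * barredAt B p)
negatives-∘ B {T} sT D E shift = begin
  negatives (B ∘ T) + sum (λ p → D p * Y p)
    ≡⟨ cong (_+ sum (λ p → D p * Y p)) reindexed ⟩
  sum (λ p → [ T p <ᶠ opposite (T p) ] * Y p) + sum (λ p → D p * Y p)
    ≡⟨ ∑-distrib-+ (λ p → [ T p <ᶠ opposite (T p) ] * Y p) (λ p → D p * Y p) ⟨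
  sum (λ p → [ T p <ᶠ opposite (T p) ] * Y p + D p * Y p)
    ≡⟨ sum-cong-≗ (λ p → trans (sym (*-distribʳ-+ (Y p) [ T p <ᶠ opposite (T p) ] (D p)))
                             (trans (cong (_* Y p) (shift p)) (*-distribʳ-+ (Y p) [ p <ᶠ opposite p ] (E p)))) ⟩
  sum (λ p → [ p <ᶠ opposite p ] * Y p + E p * Y p)
    ≡⟨ ∑-distrib-+ (λ p → [ p <ᶠ opposite p ] * Y p) (λ p → E p * Y p) ⟩
  negatives B + sum (λ p → E p * Y p) ∎
  where
  open ≡-Reasoning
  open IsSignedInvolution sT
  Y = barredAt B
  reindexed : negatives (B ∘ T) ≡ sum (λ p → [ T p <ᶠ opposite (T p) ] * Y p)
  reindexed = trans (sum-cong-≗ (λ p → cong (λ x → [ p <ᶠ opposite p ] * 𝟙 (B x <? B (T p))) (opposite-comm p)))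
    (trans (sum-involution T involutive (λ p → [ p <ᶠ opposite p ] * 𝟙 (B (opposite (T p)) <? B (T p))))
           (sum-cong-≗ (λ p → cong (λ x → [ T p <ᶠ opposite (T p) ] * 𝟙 (B (opposite x) <? B x)) (involutive p))))

2*lenℕ : ∀ {n U} → IsSigned n U → 2 * lenℕ n U ≡ inversions U + negatives U
2*lenℕ {n} {U} sU = 2*lenℕ≡inversions+negatives n U (IsSigned.complement sU)


-- The three kinds of reflections

module Halves (n : ℕ) where

  lower : Fin n → Fin (n + n)
  lower i = i ↑ˡ n

  lower<n : ∀ i → toℕ (lower i) < n
  lower<n i = subst (_< n) (sym (toℕ-↑ˡ i n)) (toℕ<n i)

  n≤upper : ∀ i → n ≤ toℕ (opposite (lower i))
  n≤upper i = complement-lower (opposite-complement (lower i)) (lower<n i)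

  lower≢upper : ∀ i j → ¬ lower i ≡ opposite (lower j)
  lower≢upper i j e = n≮n n (≤-<-trans (n≤upper j) (subst (λ x → toℕ x < n) e (lower<n i)))

-- For each positive root, T is the permutation of positions induced by s_α (Defs.refl); a position
-- i ∈ [n] is lower i, in the lower half, and its bar lies in the upper half.
module Reflections (n : ℕ) where
  open Halves n

  module 2εᵢ (i : Fin n) where
    a = lower i
    ā = opposite a
    T = transpose a ā

    involution : IsSignedInvolution T
    involution = transpose-self-opposite a

    a<ā : toℕ a < toℕ ā
    a<ā = <-≤-trans (lower<n i) (n≤upper i)

    T-a : T a ≡ ā
    T-a = transpose-matchˡ a ā

    T-ā : T ā ≡ a
    T-ā = transpose-matchʳ a ā

    T-between : ∀ k → toℕ a < toℕ k → toℕ k < toℕ ā → T k ≡ k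
    T-between k a<k k<ā = transpose-mismatch a ā k (λ { refl → n≮n _ a<k }) (λ { refl → n≮n _ k<ā })

    2+width≡2*ρ : 2 + width a ā ≡ 2 * (n ∸ toℕ i)
    2+width≡2*ρ = +-cancelʳ-≡ (2 * toℕ i) _ _ (begin
      2 + width a ā + 2 * toℕ i                 ≡⟨ regroup (width a ā) (toℕ i) ⟩
      width a ā + suc (toℕ i) + suc (toℕ i)     ≡⟨ cong (λ x → width a ā + suc x + suc (toℕ i)) (toℕ-↑ˡ i n) ⟨
      width a ā + suc (toℕ a) + suc (toℕ i)     ≡⟨ cong (_+ suc (toℕ i)) (width-+ a ā a<ā) ⟩
      toℕ ā + suc (toℕ i)                       ≡⟨ cong (λ x → toℕ ā + suc x) (toℕ-↑ˡ i n) ⟨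
      toℕ ā + suc (toℕ a)                       ≡⟨ opposite-complement a ⟩
      n + n                                     ≡⟨ cong₂ _+_ ρ+i≡n ρ+i≡n ⟨
      (n ∸ toℕ i) + toℕ i + ((n ∸ toℕ i) + toℕ i) ≡⟨ double (n ∸ toℕ i) (toℕ i) ⟩
      2 * (n ∸ toℕ i) + 2 * toℕ i ∎)
      where
      open ≡-Reasoning
      ρ+i≡n : (n ∸ toℕ i) + toℕ i ≡ n
      ρ+i≡n = m∸n+n≡m (<⇒≤ (toℕ<n i))
      regroup : ∀ w x → 2 + w + 2 * x ≡ w + suc x + suc x
      regroup = solve-∀
      double : ∀ r x → r + x + (r + x) ≡ 2 * r + 2 * x
      double = solve-∀

  module εᵢ-εⱼ (i j : Fin n) (i<j : toℕ i < toℕ j) where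
    a = lower i
    b = lower j
    ā = opposite a
    b̄ = opposite b
    T = pairedTranspose a b

    a<b : toℕ a < toℕ b
    a<b = subst₂ _<_ (sym (toℕ-↑ˡ i n)) (sym (toℕ-↑ˡ j n)) i<j

    involution : IsSignedInvolution T
    involution = pairedTranspose-signed (lower≢upper i j) (lower≢upper i i) (lower≢upper j j) (lower≢upper j i)

    upper-untouched : ∀ k → n ≤ toℕ k → transpose a b k ≡ k
    upper-untouched k n≤k = transpose-mismatch a b k (λ { refl → n≮n n (≤-<-trans n≤k (lower<n i)) })
                                                     (λ { refl → n≮n n (≤-<-trans n≤k (lower<n j)) })

    lower-untouched : ∀ k → toℕ k < n → transpose b̄ ā k ≡ k
    lower-untouched k k<n = transpose-mismatch b̄ ā k (λ { refl → n≮n n (≤-<-trans (n≤upper j) k<n) })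
                                                    (λ { refl → n≮n n (≤-<-trans (n≤upper i) k<n) })

    T-a : T a ≡ b
    T-a = trans (cong (transpose a b) (lower-untouched a (lower<n i))) (transpose-matchˡ a b)

    T-b : T b ≡ a
    T-b = trans (cong (transpose a b) (lower-untouched b (lower<n j))) (transpose-matchʳ a b)

    T-between : ∀ k → toℕ a < toℕ k → toℕ k < toℕ b → T k ≡ k
    T-between k a<k k<b = trans (cong (transpose a b) (lower-untouched k (<-trans k<b (lower<n j))))
                                (transpose-mismatch a b k (λ { refl → n≮n _ a<k }) (λ { refl → n≮n _ k<b }))

    2+2*width≡2*ρ : 2 + 2 * width a b ≡ 2 * (toℕ j ∸ toℕ i)
    2+2*width≡2*ρ = trans (double-suc (width a b)) (cong (2 *_) (+-cancelʳ-≡ (toℕ i) _ _ (begin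
      suc (width a b) + toℕ i   ≡⟨ +-suc (width a b) (toℕ i) ⟨
      width a b + suc (toℕ i)   ≡⟨ cong (λ x → width a b + suc x) (toℕ-↑ˡ i n) ⟨
      width a b + suc (toℕ a)   ≡⟨ width-+ a b a<b ⟩
      toℕ b                     ≡⟨ toℕ-↑ˡ j n ⟩
      toℕ j                     ≡⟨ m∸n+n≡m (<⇒≤ i<j) ⟨
      (toℕ j ∸ toℕ i) + toℕ i ∎)))
      where
      open ≡-Reasoning
      double-suc : ∀ w → 2 + 2 * w ≡ 2 * suc w
      double-suc = solve-∀

  module εᵢ+εⱼ (i j : Fin n) (i<j : toℕ i < toℕ j) where
    a = lower i
    b = lower j
    ā = opposite a
    b̄ = opposite b
    T : Fin (n + n) → Fin (n + n)
    T p = transpose a b̄ (transpose b ā p)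

    a≢b : ¬ a ≡ b
    a≢b e = <-irrefl (trans (sym (toℕ-↑ˡ i n)) (trans (cong toℕ e) (toℕ-↑ˡ j n))) i<j

    b≢b̄ : ¬ b ≡ b̄
    b≢b̄ = lower≢upper j j

    involution : IsSignedInvolution T
    involution = IsSignedInvolution-≗ (λ p → cong (λ x → transpose a b̄ (transpose x ā p)) (opposite-involutive b))
      (pairedTranspose-signed (λ e → a≢b (trans e (opposite-involutive b))) (lower≢upper i i)
                              (λ e → lower≢upper j j (sym (trans e (opposite-involutive b)))) (λ e → a≢b (sym (opposite-injective e))))

    a<b̄ : toℕ a < toℕ b̄
    a<b̄ = <-≤-trans (lower<n i) (n≤upper j)

    b<ā : toℕ b < toℕ ā
    b<ā = <-≤-trans (lower<n j) (n≤upper i)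

    ρ : ℕ
    ρ = (n + n) ∸ (toℕ i + toℕ j)

    private
      width-+2 : ∀ (c d : Fin n) → toℕ (lower c) < toℕ (opposite (lower d)) → toℕ c + toℕ d ≡ toℕ i + toℕ j →
                 width (lower c) (opposite (lower d)) + 2 ≡ ρ
      width-+2 c d c<d̄ c+d≡i+j = +-cancelʳ-≡ (toℕ i + toℕ j) _ _ (begin
        w + 2 + (toℕ i + toℕ j)                    ≡⟨ cong (w + 2 +_) c+d≡i+j ⟨
        w + 2 + (toℕ c + toℕ d)                    ≡⟨ regroup w (toℕ c) (toℕ d) ⟩
        w + suc (toℕ c) + suc (toℕ d)              ≡⟨ cong₂ (λ x y → w + suc x + suc y) (toℕ-↑ˡ c n) (toℕ-↑ˡ d n) ⟨
        w + suc (toℕ (lower c)) + suc (toℕ (lower d)) ≡⟨ cong (_+ suc (toℕ (lower d))) (width-+ (lower c) (opposite (lower d)) c<d̄) ⟩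
        toℕ (opposite (lower d)) + suc (toℕ (lower d)) ≡⟨ opposite-complement (lower d) ⟩
        n + n                                      ≡⟨ m∸n+n≡m (+-mono-≤ (<⇒≤ (toℕ<n i)) (<⇒≤ (toℕ<n j))) ⟨
        ρ + (toℕ i + toℕ j) ∎)
        where
        open ≡-Reasoning
        w = width (lower c) (opposite (lower d))
        regroup : ∀ w x y → w + 2 + (x + y) ≡ w + suc x + suc y
        regroup = solve-∀

    width-a-b̄+2 : width a b̄ + 2 ≡ ρ
    width-a-b̄+2 = width-+2 i j a<b̄ refl

    width-b-ā+2 : width b ā + 2 ≡ ρ
    width-b-ā+2 = width-+2 j i b<ā (+-comm (toℕ j) (toℕ i))

    T-a : T a ≡ b̄
    T-a = trans (cong (transpose a b̄) (transpose-mismatch b ā a (a≢b) (lower≢upper i i))) (transpose-matchˡ a b̄)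

    T-b̄ : T b̄ ≡ a
    T-b̄ = trans (cong (transpose a b̄) (transpose-mismatch b ā b̄ (b≢b̄ ∘ sym) (λ e → a≢b (sym (opposite-injective e)))))
                (transpose-matchʳ a b̄)

module LengthChange {n} {B : Fin (n + n) → ℕ} (sB : IsSigned n B) where
  open IsSigned sB
  open Halves n

  private
    lowerness : Fin (n + n) → ℕ
    lowerness p = [ p <ᶠ opposite p ]

    lowerness-lower : ∀ i → lowerness (lower i) ≡ 1
    lowerness-lower i = trans ([<ᶠ]-opposite-self n (lower i)) (𝟙-yes (toℕ (lower i) <? n) (lower<n i))

    lowerness-upper : ∀ i → lowerness (opposite (lower i)) ≡ 0
    lowerness-upper i = trans ([<ᶠ]-opposite-self n (opposite (lower i))) (𝟙-no (toℕ (opposite (lower i)) <? n) (≤⇒≯ (n≤upper i)))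

  module 2εᵢ (i : Fin n) where
    open Reflections.2εᵢ n i public

    negatives-∘T : B a < B ā → negatives (B ∘ T) ≡ suc (negatives B)
    negatives-∘T lt = begin
      negatives (B ∘ T)                                       ≡⟨ +-identityʳ _ ⟨
      negatives (B ∘ T) + 0                                   ≡⟨ cong (negatives (B ∘ T) +_) (trans (sum-𝟙≟-* a _) (proj₁ (barredAt-< B lt))) ⟨
      negatives (B ∘ T) + sum (λ p → 𝟙 (p ≟ a) * barredAt B p)
        ≡⟨ negatives-∘ B involution (λ p → 𝟙 (p ≟ a)) (λ p → 𝟙 (p ≟ ā))
             (λ p → transpose-shift lowerness a ā p (trans (cong (_+ 1) (lowerness-upper i)) (sym (lowerness-lower i)))) ⟩
      negatives B + sum (λ p → 𝟙 (p ≟ ā) * barredAt B p)     ≡⟨ cong (negatives B +_) (trans (sum-𝟙≟-* ā _) (proj₂ (barredAt-< B lt))) ⟩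
      negatives B + 1                                         ≡⟨ +-comm (negatives B) 1 ⟩
      suc (negatives B) ∎
      where open ≡-Reasoning

    lenℕ-∘T : B a < B ā → lenℕ n (B ∘ T) ≡ suc (lenℕ n B + pointsBetween a ā B)
    lenℕ-∘T lt = *-cancelˡ-≡ _ _ 2 (begin
      2 * lenℕ n (B ∘ T)                                         ≡⟨ 2*lenℕ (IsSigned-∘ sB involution) ⟩
      inversions (B ∘ T) + negatives (B ∘ T)                     ≡⟨ cong₂ _+_ (inversions-transpose B injective a<ā lt)
                                                                             (negatives-∘T lt) ⟩
      inversions B + suc (2 * C) + suc (negatives B)             ≡⟨ rearrange (inversions B) (negatives B) C ⟩
      inversions B + negatives B + 2 * suc C                     ≡⟨ cong (_+ 2 * suc C) (2*lenℕ sB) ⟨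
      2 * lenℕ n B + 2 * suc C                                   ≡⟨ *-distribˡ-+ 2 (lenℕ n B) (suc C) ⟨
      2 * (lenℕ n B + suc C)                                     ≡⟨ cong (2 *_) (+-suc (lenℕ n B) C) ⟩
      2 * suc (lenℕ n B + C) ∎)
      where
      open ≡-Reasoning
      C = pointsBetween a ā B
      rearrange : ∀ i g c → i + suc (2 * c) + suc g ≡ i + g + 2 * suc c
      rearrange = solve-∀

  module εᵢ-εⱼ (i j : Fin n) (i<j : toℕ i < toℕ j) where
    open Reflections.εᵢ-εⱼ n i j i<j public

    negatives-∘T : negatives (B ∘ T) ≡ negatives B
    negatives-∘T = begin
      negatives (B ∘ T)                                ≡⟨ pad (negatives (B ∘ T)) ⟩
      negatives (B ∘ T) + sum (λ p → 0 * barredAt B p) ≡⟨ negatives-∘ B involution (λ _ → 0) (λ _ → 0) same-lowerness ⟩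
      negatives B + sum (λ p → 0 * barredAt B p)       ≡⟨ pad (negatives B) ⟨
      negatives B ∎
      where
      open ≡-Reasoning
      pad : ∀ x → x ≡ x + sum (λ p → 0 * barredAt B p)
      pad x = sym (trans (cong (x +_) (sum-zero (λ p → 0 * barredAt B p) (λ _ → refl))) (+-identityʳ x))
      same-lowerness : ∀ p → lowerness (T p) + 0 ≡ lowerness p + 0
      same-lowerness p = cong (_+ 0) (trans
        (transpose-preserves lowerness a b _ (trans (lowerness-lower i) (sym (lowerness-lower j))))
        (transpose-preserves lowerness b̄ ā p (trans (lowerness-upper j) (sym (lowerness-upper i)))))

    pointsBetween-reflected : pointsBetween b̄ ā (B ∘ transpose a b) ≡ pointsBetween a b B
    pointsBetween-reflected = begin
      pointsIn b̄ ā (B (transpose a b b̄)) (B (transpose a b ā)) (B ∘ transpose a b)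
        ≡⟨ cong₂ (λ x y → pointsIn b̄ ā (B x) (B y) (B ∘ transpose a b))
             (upper-untouched b̄ (n≤upper j)) (upper-untouched ā (n≤upper i)) ⟩
      pointsIn b̄ ā (B b̄) (B ā) (B ∘ transpose a b)
        ≡⟨ pointsIn-cong b̄ ā (B b̄) (B ā) (λ k b̄<k _ → cong B (upper-untouched k (<⇒≤ (≤-<-trans (n≤upper j) b̄<k)))) ⟩
      pointsIn b̄ ā (B b̄) (B ā) B
        ≡⟨ pointsIn-opposite B complement a b (complement a) (complement b) ⟩
      pointsBetween a b B ∎
      where open ≡-Reasoning

    lenℕ-∘T : B a < B b → lenℕ n (B ∘ T) ≡ suc (lenℕ n B + 2 * pointsBetween a b B)
    lenℕ-∘T Ba<Bb = *-cancelˡ-≡ _ _ 2 (begin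
      2 * lenℕ n (B ∘ T)                                     ≡⟨ 2*lenℕ (IsSigned-∘ sB involution) ⟩
      inversions (B ∘ T) + negatives (B ∘ T)                 ≡⟨ cong₂ _+_ inversions-paired negatives-∘T ⟩
      inversions B + suc (2 * C) + suc (2 * C) + negatives B ≡⟨ rearrange (inversions B) (negatives B) C ⟩
      inversions B + negatives B + 2 * suc (2 * C)           ≡⟨ cong (_+ 2 * suc (2 * C)) (2*lenℕ sB) ⟨
      2 * lenℕ n B + 2 * suc (2 * C)                         ≡⟨ *-distribˡ-+ 2 (lenℕ n B) _ ⟨
      2 * (lenℕ n B + suc (2 * C))                           ≡⟨ cong (2 *_) (+-suc (lenℕ n B) (2 * C)) ⟩
      2 * suc (lenℕ n B + 2 * C) ∎)
      where
      open ≡-Reasoning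
      C = pointsBetween a b B
      rearrange : ∀ i g c → i + suc (2 * c) + suc (2 * c) + g ≡ i + g + 2 * suc (2 * c)
      rearrange = solve-∀
      inversions-paired : inversions (B ∘ T) ≡ inversions B + suc (2 * C) + suc (2 * C)
      inversions-paired = trans
        (inversions-transpose² B injective a<b Ba<Bb
          (complement-reverses-< (opposite-complement a) (opposite-complement b) a<b) (complement-reverses-< (complement a) (complement b) Ba<Bb)
          (lower≢upper i j ∘ sym) (lower≢upper j j ∘ sym) (lower≢upper i i ∘ sym) (lower≢upper j i ∘ sym))
        (cong (λ x → inversions B + suc (2 * C) + suc (2 * x)) pointsBetween-reflected)

  module εᵢ+εⱼ (i j : Fin n) (i<j : toℕ i < toℕ j) where
    open Reflections.εᵢ+εⱼ n i j i<j public

    B₁ = B ∘ transpose a b̄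

    negatives-∘T : negatives (B ∘ T) + (barredAt B a + barredAt B b) ≡ negatives B + (barredAt B ā + barredAt B b̄)
    negatives-∘T = begin
      negatives (B ∘ T) + (barredAt B a + barredAt B b)
        ≡⟨ cong (negatives (B ∘ T) +_) (sum-𝟙≟+𝟙≟-* a b (barredAt B)) ⟨
      negatives (B ∘ T) + sum (λ p → (𝟙 (p ≟ a) + 𝟙 (p ≟ b)) * barredAt B p)
        ≡⟨ negatives-∘ B involution (λ p → 𝟙 (p ≟ a) + 𝟙 (p ≟ b)) (λ p → 𝟙 (p ≟ ā) + 𝟙 (p ≟ b̄)) shift ⟩
      negatives B + sum (λ p → (𝟙 (p ≟ ā) + 𝟙 (p ≟ b̄)) * barredAt B p)
        ≡⟨ cong (negatives B +_) (sum-𝟙≟+𝟙≟-* ā b̄ (barredAt B)) ⟩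
      negatives B + (barredAt B ā + barredAt B b̄) ∎
      where
      open ≡-Reasoning
      swap-last : ∀ x y z → x + y + z ≡ x + z + y
      swap-last = solve-∀
      shift : ∀ p → lowerness (T p) + (𝟙 (p ≟ a) + 𝟙 (p ≟ b)) ≡ lowerness p + (𝟙 (p ≟ ā) + 𝟙 (p ≟ b̄))
      shift p = begin
        lowerness (T p) + (𝟙 (p ≟ a) + 𝟙 (p ≟ b))  ≡⟨ +-assoc (lowerness (T p)) _ _ ⟨
        lowerness (T p) + 𝟙 (p ≟ a) + 𝟙 (p ≟ b)    ≡⟨ cong (λ x → lowerness (T p) + x + 𝟙 (p ≟ b))
                                                        (𝟙≟-transpose b ā p a a≢b (lower≢upper i i)) ⟨
        lowerness (T p) + 𝟙 (q ≟ a) + 𝟙 (p ≟ b)    ≡⟨ cong (_+ 𝟙 (p ≟ b)) (transpose-shift lowerness a b̄ q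
                                                        (trans (cong (_+ 1) (lowerness-upper j)) (sym (lowerness-lower i)))) ⟩
        lowerness q + 𝟙 (q ≟ b̄) + 𝟙 (p ≟ b)        ≡⟨ cong (λ x → lowerness q + x + 𝟙 (p ≟ b)) (𝟙≟-transpose b ā p b̄ (b≢b̄ ∘ sym)
                                                        (λ e → a≢b (sym (opposite-injective e)))) ⟩
        lowerness q + 𝟙 (p ≟ b̄) + 𝟙 (p ≟ b)        ≡⟨ swap-last (lowerness q) _ _ ⟩
        lowerness q + 𝟙 (p ≟ b) + 𝟙 (p ≟ b̄)        ≡⟨ cong (_+ 𝟙 (p ≟ b̄)) (transpose-shift lowerness b ā p
                                                        (trans (cong (_+ 1) (lowerness-upper i)) (sym (lowerness-lower j)))) ⟩
        lowerness p + 𝟙 (p ≟ ā) + 𝟙 (p ≟ b̄)        ≡⟨ +-assoc (lowerness p) _ _ ⟩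
        lowerness p + (𝟙 (p ≟ ā) + 𝟙 (p ≟ b̄)) ∎
        where q = transpose b ā p

    C₁ C₂ : ℕ
    C₁ = pointsBetween a b̄ B
    C₂ = pointsBetween b ā B₁

    2*lenℕ-∘T : B a < B b̄ →
      2 * lenℕ n (B ∘ T) + (barredAt B a + barredAt B b) ≡ 2 * lenℕ n B + 2 + 2 * C₁ + 2 * C₂ + (barredAt B ā + barredAt B b̄)
    2*lenℕ-∘T Ba<Bb̄ = begin
      2 * lenℕ n (B ∘ T) + (Y a + Y b)                     ≡⟨ cong (_+ (Y a + Y b)) (2*lenℕ (IsSigned-∘ sB involution)) ⟩
      inversions (B ∘ T) + negatives (B ∘ T) + (Y a + Y b) ≡⟨ +-assoc (inversions (B ∘ T)) _ _ ⟩
      inversions (B ∘ T) + (negatives (B ∘ T) + (Y a + Y b)) ≡⟨ cong₂ _+_ inversions-mixed negatives-∘T ⟩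
      inversions B + suc (2 * C₁) + suc (2 * C₂) + (negatives B + (Y ā + Y b̄))
        ≡⟨ rearrange (inversions B) (negatives B) C₁ C₂ (Y ā + Y b̄) ⟩
      inversions B + negatives B + 2 + 2 * C₁ + 2 * C₂ + (Y ā + Y b̄)
        ≡⟨ cong (λ x → x + 2 + 2 * C₁ + 2 * C₂ + (Y ā + Y b̄)) (2*lenℕ sB) ⟨
      2 * lenℕ n B + 2 + 2 * C₁ + 2 * C₂ + (Y ā + Y b̄) ∎
      where
      open ≡-Reasoning
      Y = barredAt B
      rearrange : ∀ i g c d y → i + suc (2 * c) + suc (2 * d) + (g + y) ≡ i + g + 2 + 2 * c + 2 * d + y
      rearrange = solve-∀
      inversions-mixed : inversions (B ∘ T) ≡ inversions B + suc (2 * C₁) + suc (2 * C₂)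
      inversions-mixed = inversions-transpose² B injective a<b̄ Ba<Bb̄ b<ā
        (complement-reverses-< (complement a) (complement-sym (complement b)) Ba<Bb̄)
        (a≢b ∘ sym) b≢b̄ (lower≢upper i i ∘ sym) (λ e → a≢b (opposite-injective e))

    -- B ∘ transpose a b̄ differs from B strictly between b and ā only at b̄; the remaining count is
    -- C₁ reflected through the middle.
    pointsBetween-shifted : C₂ + 𝟙 (B b <? B b̄) * 𝟙 (B b̄ <? B ā) ≡ C₁ + 𝟙 (B b <? B a) * 𝟙 (B a <? B ā)
    pointsBetween-shifted = begin
      C₂ + window (B b̄)
        ≡⟨ cong₂ (λ x y → pointsIn b ā (B x) (B y) B₁ + window (B b̄)) fixes-b fixes-ā ⟩
      sum f + window (B b̄)                 ≡⟨ cong (sum f +_) (at-b̄ B) ⟨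
      sum f + g b̄                          ≡⟨ sum-update f g b̄ agree ⟩
      sum g + f b̄                          ≡⟨ cong₂ _+_ reflected (trans (at-b̄ B₁) (cong window (cong B (transpose-matchʳ a b̄)))) ⟩
      C₁ + window (B a) ∎
      where
      open ≡-Reasoning
      window : ℕ → ℕ
      window x = 𝟙 (B b <? x) * 𝟙 (x <? B ā)
      f g : Fin (n + n) → ℕ
      f k = between b ā k * window (B₁ k)
      g k = between b ā k * window (B k)
      fixes-b : transpose a b̄ b ≡ b
      fixes-b = transpose-mismatch a b̄ b (a≢b ∘ sym) b≢b̄
      fixes-ā : transpose a b̄ ā ≡ ā
      fixes-ā = transpose-mismatch a b̄ ā (lower≢upper i i ∘ sym) (λ e → a≢b (opposite-injective e))
      b<b̄<ā : between b ā b̄ ≡ 1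
      b<b̄<ā = between≡1 b ā b̄ (<-≤-trans (lower<n j) (n≤upper j))
        (complement-reverses-< (opposite-complement a) (opposite-complement b) (subst₂ _<_ (sym (toℕ-↑ˡ i n)) (sym (toℕ-↑ˡ j n)) i<j))
      at-b̄ : (V : Fin (n + n) → ℕ) → between b ā b̄ * window (V b̄) ≡ window (V b̄)
      at-b̄ V = trans (cong (_* window (V b̄)) b<b̄<ā) (+-identityʳ _)
      agree : ∀ k → ¬ k ≡ b̄ → f k ≡ g k
      agree k k≢b̄ = between-*-cong b ā k (λ b<k _ → cong (λ x → window (B x))
        (transpose-mismatch a b̄ k (λ { refl → <-asym b<k (subst₂ _<_ (sym (toℕ-↑ˡ i n)) (sym (toℕ-↑ˡ j n)) i<j) }) k≢b̄))
      reflected : sum g ≡ C₁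
      reflected = trans (cong (λ x → pointsIn x ā (B x) (B ā) B) (sym (opposite-involutive b)))
                        (pointsIn-opposite B complement a b̄ (complement a) (complement b̄))


-- Circular order

arcPos : ℕ → ℕ → ℕ → ℕ
arcPos N x z = if does (x ≤? z) then z ∸ x else (z + N) ∸ x

InArc : ℕ → ℕ → ℕ → ℕ → Set
InArc N x z y = arcPos N x x < arcPos N x z × arcPos N x z < arcPos N x y

u∸x<v∸x⇒u<v : ∀ x {u v} → u ∸ x < v ∸ x → u < v
u∸x<v∸x⇒u<v x {u} {v} lt with u <? v
... | yes u<v = u<v
... | no u≮v = ⊥-elim (<⇒≱ lt (∸-monoˡ-≤ x (≮⇒≥ u≮v)))

module _ {N x : ℕ} where

  arcPos-above : ∀ {z} → x ≤ z → arcPos N x z ≡ z ∸ x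
  arcPos-above {z} x≤z = cong (λ c → if c then z ∸ x else (z + N) ∸ x) (dec-true (x ≤? z) x≤z)

  arcPos-below : ∀ {z} → z < x → arcPos N x z ≡ (z + N) ∸ x
  arcPos-below {z} z<x = cong (λ c → if c then z ∸ x else (z + N) ∸ x) (dec-false (x ≤? z) (<⇒≱ z<x))

  arcPos-self : arcPos N x x ≡ 0
  arcPos-self = trans (arcPos-above ≤-refl) (n∸n≡0 x)

  InArc-ascending : ∀ {z y} → x < y → y < N → InArc N x z y ⇔ (x < z × z < y)
  InArc-ascending {z} {y} x<y y<N = mk⇔ to from
    where
    to : InArc N x z y → x < z × z < y
    to (start<z , z<end) with x ≤? z
    ... | yes x≤z = ≤∧≢⇒< x≤z (λ { refl → n≮n 0 (subst₂ _<_ arcPos-self arcPos-self start<z) })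
                  , u∸x<v∸x⇒u<v x (subst₂ _<_ (arcPos-above x≤z) (arcPos-above (<⇒≤ x<y)) z<end)
    ... | no x≰z = ⊥-elim (<⇒≱ (u∸x<v∸x⇒u<v x (subst₂ _<_ (arcPos-below (≰⇒> x≰z)) (arcPos-above (<⇒≤ x<y)) z<end))
                                (≤-trans (<⇒≤ y<N) (m≤n+m N z)))
    from : x < z × z < y → InArc N x z y
    from (x<z , z<y) = subst₂ _<_ (sym arcPos-self) (sym (arcPos-above (<⇒≤ x<z))) (m<n⇒0<n∸m x<z)
                     , subst₂ _<_ (sym (arcPos-above (<⇒≤ x<z))) (sym (arcPos-above (<⇒≤ x<y))) (∸-monoˡ-< z<y (<⇒≤ x<z))

  ¬InArc-descending : ∀ {z y} → y < x → x < N → z < N → ¬ z ≡ x → ¬ z ≡ y → (¬ InArc N x z y) ⇔ (y < z × z < x)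
  ¬InArc-descending {z} {y} y<x x<N z<N z≢x z≢y = mk⇔ to from
    where
    x≤wrapped : ∀ {u} → x ≤ u + N
    x≤wrapped {u} = ≤-trans (<⇒≤ x<N) (m≤n+m N u)
    end≡ : arcPos N x y ≡ (y + N) ∸ x
    end≡ = arcPos-below y<x
    arc-above : x < z → InArc N x z y
    arc-above x<z = subst₂ _<_ (sym arcPos-self) (sym (arcPos-above (<⇒≤ x<z))) (m<n⇒0<n∸m x<z)
                  , subst₂ _<_ (sym (arcPos-above (<⇒≤ x<z))) (sym end≡) (∸-monoˡ-< (≤-trans z<N (m≤n+m N y)) (<⇒≤ x<z))
    arc-below : z < x → z < y → InArc N x z y
    arc-below z<x z<y = subst₂ _<_ (sym arcPos-self) (sym (arcPos-below z<x)) (m<n⇒0<n∸m (<-≤-trans x<N (m≤n+m N z)))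
                      , subst₂ _<_ (sym (arcPos-below z<x)) (sym end≡) (∸-monoˡ-< (+-monoˡ-< N z<y) x≤wrapped)
    to : ¬ InArc N x z y → y < z × z < x
    to ¬arc with <-cmp z x | <-cmp z y
    ... | tri> _ _ x<z | _ = ⊥-elim (¬arc (arc-above x<z))
    ... | tri≈ _ z≡x _ | _ = ⊥-elim (z≢x z≡x)
    ... | tri< z<x _ _ | tri< z<y _ _ = ⊥-elim (¬arc (arc-below z<x z<y))
    ... | tri< _ _ _ | tri≈ _ z≡y _ = ⊥-elim (z≢y z≡y)
    ... | tri< z<x _ _ | tri> _ _ y<z = y<z , z<x
    from : y < z × z < x → ¬ InArc N x z y
    from (y<z , z<x) (_ , z<end) = <⇒≱ y<z (<⇒≤ (+-cancelʳ-< N z y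
      (u∸x<v∸x⇒u<v x (subst₂ _<_ (arcPos-below z<x) end≡ z<end))))


-- Quantum Bruhat steps

-- QBGEdge with L′ = ℓ(w s_α), L = ℓ(w) and ρ = ⟨ρ, α^∨⟩.
QuantumStep : ℕ → ℕ → ℕ → Set
QuantumStep L′ L ρ = L′ ≡ suc L ⊎ L′ + 2 * ρ ≡ suc L

QuantumStep-up : ∀ {L L′ m ρ} → 0 < ρ → L′ ≡ suc (L + m) → QuantumStep L′ L ρ ⇔ m ≡ 0
QuantumStep-up {L} {L′} {m} {ρ} 0<ρ refl = mk⇔ to from
  where
  to : QuantumStep (suc (L + m)) L ρ → m ≡ 0
  to (inj₁ e) = +-cancelˡ-≡ L m 0 (trans (suc-injective e) (sym (+-identityʳ L)))
  to (inj₂ e) = ⊥-elim (<-irrefl (sym e) (begin-strict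
    suc L                 ≤⟨ s≤s (m≤m+n L m) ⟩
    suc (L + m)           <⟨ m<m+n (suc (L + m)) (≤-trans 0<ρ (m≤m+n ρ (ρ + 0))) ⟩
    suc (L + m) + 2 * ρ   ∎))
    where open ≤-Reasoning
  from : m ≡ 0 → QuantumStep (suc (L + m)) L ρ
  from refl = inj₁ (cong suc (+-identityʳ L))

QuantumStep-down : ∀ {L L′ m ρ} → L ≡ suc (L′ + m) → QuantumStep L′ L ρ ⇔ 2 + m ≡ 2 * ρ
QuantumStep-down {L} {L′} {m} {ρ} refl = mk⇔ to from
  where
  shift : ∀ l k → suc (suc (l + k)) ≡ l + (2 + k)
  shift = solve-∀
  to : QuantumStep L′ (suc (L′ + m)) ρ → 2 + m ≡ 2 * ρ
  to (inj₁ e) = ⊥-elim (<-irrefl e (s≤s (≤-trans (m≤m+n L′ m) (n≤1+n _))))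
  to (inj₂ e) = sym (+-cancelˡ-≡ L′ (2 * ρ) (2 + m) (trans e (shift L′ m)))
  from : 2 + m ≡ 2 * ρ → QuantumStep L′ (suc (L′ + m)) ρ
  from e = inj₂ (trans (cong (L′ +_) (sym e)) (sym (shift L′ m)))

no-quantum-step : ∀ {L L′ A V c₁ c₂ ρ} → A ≤ 2 → V ≤ 2 → c₁ + 2 ≤ ρ → c₂ + 2 ≤ ρ →
                  2 * L + A ≡ 2 * L′ + 2 + 2 * c₁ + 2 * c₂ + V → ¬ QuantumStep L′ L ρ
no-quantum-step {L} {L′} {A} {V} {c₁} {c₂} {ρ} A≤2 V≤2 c₁+2≤ρ c₂+2≤ρ e (inj₁ refl) =
  n≮n (2 * L + 2) (begin-strict
    2 * L + 2                                <⟨ +-monoʳ-< (2 * L) (s≤s (s≤s (s≤s z≤n))) ⟩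
    2 * L + 4                                ≤⟨ m≤m+n (2 * L + 4) (2 * c₁ + 2 * c₂ + V) ⟩
    2 * L + 4 + (2 * c₁ + 2 * c₂ + V)        ≡⟨ regroup L c₁ c₂ V ⟩
    2 * suc L + 2 + 2 * c₁ + 2 * c₂ + V      ≡⟨ e ⟨
    2 * L + A                                ≤⟨ +-monoʳ-≤ (2 * L) A≤2 ⟩
    2 * L + 2 ∎)
  where
  open ≤-Reasoning
  regroup : ∀ l a b v → 2 * l + 4 + (2 * a + 2 * b + v) ≡ 2 * suc l + 2 + 2 * a + 2 * b + v
  regroup = solve-∀
no-quantum-step {L} {L′} {A} {V} {c₁} {c₂} {ρ} A≤2 V≤2 c₁+2≤ρ c₂+2≤ρ e (inj₂ step) =
  n≮n (X + 6) (begin-strict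
    X + 6                                    <⟨ +-monoʳ-< X (≤-trans (m≤n+m 7 A) (+-monoʳ-≤ A (n≤1+n 7))) ⟩
    X + (A + 8)                              ≡⟨ regroup₁ L′ ρ A ⟩
    (2 * L′ + 2 * (2 * ρ)) + A + 8           ≡⟨ cong (λ x → x + A + 8) (trans (sym (*-distribˡ-+ 2 L′ _)) (trans (cong (2 *_) step) (regroup₂ L))) ⟩
    2 * L + 2 + A + 8                        ≡⟨ regroup₃ L A ⟩
    2 * L + A + 10                           ≡⟨ cong (_+ 10) e ⟩
    2 * L′ + 2 + 2 * c₁ + 2 * c₂ + V + 10    ≡⟨ regroup₄ L′ c₁ c₂ V ⟩
    2 * L′ + 2 * (c₁ + 2) + 2 * (c₂ + 2) + V + 4
      ≤⟨ +-monoˡ-≤ 4 (+-mono-≤ (+-mono-≤ (+-monoʳ-≤ (2 * L′) (*-monoʳ-≤ 2 c₁+2≤ρ)) (*-monoʳ-≤ 2 c₂+2≤ρ)) V≤2) ⟩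
    2 * L′ + 2 * ρ + 2 * ρ + 2 + 4           ≡⟨ regroup₅ L′ ρ ⟩
    X + 6 ∎)
  where
  open ≤-Reasoning
  X = 2 * L′ + 4 * ρ
  regroup₁ : ∀ l r a → 2 * l + 4 * r + (a + 8) ≡ 2 * l + 2 * (2 * r) + a + 8
  regroup₁ = solve-∀
  regroup₂ : ∀ l → 2 * suc l ≡ 2 * l + 2
  regroup₂ = solve-∀
  regroup₃ : ∀ l a → 2 * l + 2 + a + 8 ≡ 2 * l + a + 10
  regroup₃ = solve-∀
  regroup₄ : ∀ l a b v → 2 * l + 2 + 2 * a + 2 * b + v + 10 ≡ 2 * l + 2 * (a + 2) + 2 * (b + 2) + v + 4
  regroup₄ = solve-∀
  regroup₅ : ∀ l r → 2 * l + 2 * r + 2 * r + 2 + 4 ≡ 2 * l + 4 * r + 6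
  regroup₅ = solve-∀

-- When U b < U a, the length formula applied to U ∘ T, whose values at a and b are swapped,
-- describes the downward edge.
module ArcCriterion {n} {U : Fin (n + n) → ℕ} (sU : IsSigned n U) {a b : Fin (n + n)} (a<b : toℕ a < toℕ b)
  {T : Fin (n + n) → Fin (n + n)} (sT : IsSignedInvolution T) (T-a : T a ≡ b) (T-b : T b ≡ a)
  (T-between : ∀ k → toℕ a < toℕ k → toℕ k < toℕ b → T k ≡ k)
  (m : ℕ) .{{_ : NonZero m}} (ρ : ℕ) (size : 2 + m * width a b ≡ 2 * ρ)
  (step : ∀ {B} → IsSigned n B → B a < B b → lenℕ n (B ∘ T) ≡ suc (lenℕ n B + m * pointsBetween a b B)) where

  open IsSigned sU
  open IsSignedInvolution sT

  ArcPoint : Fin (n + n) → Set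
  ArcPoint p = toℕ a < toℕ p × toℕ p < toℕ b × InArc (n + n) (U a) (U p) (U b)

  private
    0<ρ : 0 < ρ
    0<ρ = *-cancelˡ-< 2 0 ρ (subst (0 <_) size (s≤s z≤n))

    distinct : ∀ {p q} → toℕ p < toℕ q → ¬ U p ≡ U q
    distinct p<q e = <-irrefl (cong toℕ (injective e)) p<q

    ascending : U a < U b → QuantumStep (lenℕ n (U ∘ T)) (lenℕ n U) ρ ⇔ (¬ ∃ ArcPoint)
    ascending Ua<Ub =
      ⇔-trans (QuantumStep-up {ρ = ρ} 0<ρ (step sU Ua<Ub))
      (⇔-trans (mk⇔ (λ e → *-cancelˡ-≡ _ 0 m (trans e (sym (*-zeroʳ m)))) (λ e → trans (cong (m *_) e) (*-zeroʳ m)))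
      (⇔-trans (pointsIn≡0⇔ a b (U a) (U b) U)
               (mk⇔ (λ none (p , a<p , p<b , arc) → none p a<p p<b (Equivalence.to (arc⇔window p) arc))
                    (λ ¬arc p a<p p<b window → ¬arc (p , a<p , p<b , Equivalence.from (arc⇔window p) window)))))
      where
      arc⇔window : ∀ p → InArc (n + n) (U a) (U p) (U b) ⇔ (U a < U p × U p < U b)
      arc⇔window p = InArc-ascending Ua<Ub (IsSigned-< sU b)

    descending : U b < U a → QuantumStep (lenℕ n (U ∘ T)) (lenℕ n U) ρ ⇔ (¬ ∃ ArcPoint)
    descending Ub<Ua =
      ⇔-trans (QuantumStep-down {ρ = ρ} unfolded)
      (⇔-trans (mk⇔ (λ e → *-cancelˡ-≡ _ _ m (+-cancelˡ-≡ 2 _ _ (trans e (sym size)))) (λ e → trans (cong (λ x → 2 + m * x) e) size))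
      (⇔-trans (mk⇔ (trans (sym swapped-window)) (trans swapped-window))
      (⇔-trans (pointsIn≡width⇔ a b (U b) (U a) U)
               (mk⇔ (λ all (p , a<p , p<b , arc) → Equivalence.from (¬arc⇔window p a<p p<b) (all p a<p p<b) arc)
                    (λ ¬arc p a<p p<b → Equivalence.to (¬arc⇔window p a<p p<b) (λ arc → ¬arc (p , a<p , p<b , arc)))))))
      where
      V = U ∘ T
      Va<Vb : V a < V b
      Va<Vb = subst₂ (λ x y → U x < U y) (sym T-a) (sym T-b) Ub<Ua
      unfolded : lenℕ n U ≡ suc (lenℕ n V + m * pointsBetween a b V)
      unfolded = trans (lenℕ-cong n (λ p → cong U (sym (involutive p)))) (step (IsSigned-∘ sU sT) Va<Vb)
      swapped-window : pointsBetween a b V ≡ pointsIn a b (U b) (U a) U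
      swapped-window = trans (cong₂ (λ x y → pointsIn a b (U x) (U y) V) T-a T-b)
                             (pointsIn-cong a b (U b) (U a) (λ k a<k k<b → cong U (T-between k a<k k<b)))
      ¬arc⇔window : ∀ p → toℕ a < toℕ p → toℕ p < toℕ b → (¬ InArc (n + n) (U a) (U p) (U b)) ⇔ (U b < U p × U p < U a)
      ¬arc⇔window p a<p p<b = ¬InArc-descending Ub<Ua (IsSigned-< sU a) (IsSigned-< sU p) (distinct a<p ∘ sym) (distinct p<b)

  quantumStep⇔noArcPoint : QuantumStep (lenℕ n (U ∘ T)) (lenℕ n U) ρ ⇔ (¬ ∃ ArcPoint)
  quantumStep⇔noArcPoint with <-cmp (U a) (U b)
  ... | tri< Ua<Ub _ _ = ascending Ua<Ub
  ... | tri≈ _ Ua≡Ub _ = ⊥-elim (distinct a<b Ua≡Ub)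
  ... | tri> _ _ Ub<Ua = descending Ub<Ua


sumˡ-map-tabulate : ∀ {A : Set} m (g : Fin m → A) (f : A → ℕ) → ListAction.sum (map f (tabulate g)) ≡ sum (f ∘ g)
sumˡ-map-tabulate zero g f = refl
sumˡ-map-tabulate (suc m) g f = cong (f (g zero) +_) (sumˡ-map-tabulate m (g ∘ suc) f)

len≡lenℕ : ∀ {n} (f : Letter n → Letter n) → len f ≡ lenℕ n (λ l → toℕ (idx (f ⟨ l ⟩)))
len≡lenℕ {n} f = trans (sumˡ-map-tabulate n (λ k → k) _)
  (sum-cong-≗ (λ k → sumˡ-map-tabulate (n + n) (λ l → l)
    (λ l → 𝟙 (toℕ k ≤? absIdx {n} ⟨ l ⟩) * 𝟙 (toℕ (idx (f ⟨ l ⟩)) <? toℕ (idx (f (pos k)))))))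

idx-swap : ∀ {n} (a b : Fin (n + n)) (q : Letter n) → idx (swap ⟨ a ⟩ ⟨ b ⟩ q) ≡ transpose a b (idx q)
idx-swap a b q = go (idx q ≟ a) (idx q ≟ b)
  where
  go : (q≟a : Dec (idx q ≡ a)) (q≟b : Dec (idx q ≡ b)) →
       idx (if does q≟a then ⟨ b ⟩ else (if does q≟b then ⟨ a ⟩ else q)) ≡ transpose a b (idx q)
  go (yes q≡a) _ = sym (trans (cong (transpose a b) q≡a) (transpose-matchˡ a b))
  go (no _) (yes q≡b) = sym (trans (cong (transpose a b) q≡b) (transpose-matchʳ a b))
  go (no q≢a) (no q≢b) = sym (transpose-mismatch a b (idx q) q≢a q≢b)

QuantumStep-cong : ∀ {L₁ L₂ M₁ M₂ ρ} → L₁ ≡ L₂ → M₁ ≡ M₂ → QuantumStep L₁ M₁ ρ ⇔ QuantumStep L₂ M₂ ρ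
QuantumStep-cong refl refl = mk⇔ (λ x → x) (λ x → x)

module Encoding {n} (w : SignedPerm n) where

  U : Fin (n + n) → ℕ
  U p = toℕ (idx (fun w ⟨ p ⟩))

  signed : IsSigned n U
  signed = record
    { complement = λ p → trans (cong (λ x → toℕ (idx x) + suc (U p)) (bar-com w ⟨ p ⟩)) (opposite-complement (idx (fun w ⟨ p ⟩)))
    ; injective  = λ e → cong idx (inj w (cong ⟨_⟩ (toℕ-injective e)))
    }

  QBGEdge⇔QuantumStep : ∀ α {T : Fin (n + n) → Fin (n + n)} → (∀ p → idx (reflection α ⟨ p ⟩) ≡ T p) →
                        QBGEdge w α ⇔ QuantumStep (lenℕ n (U ∘ T)) (lenℕ n U) (rhoPair α)
  QBGEdge⇔QuantumStep α reflection≡T = QuantumStep-cong {ρ = rhoPair α}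
    (trans (len≡lenℕ (rmul (fun w) α)) (lenℕ-cong n (λ l → cong (λ p → toℕ (idx (fun w ⟨ p ⟩))) (reflection≡T l))))
    (len≡lenℕ (fun w))

  open Halves n
  open LengthChange signed

  edge-εᵢ-εⱼ : (i j : Fin n) (i<j : toℕ i < toℕ j) →
    QBGEdge w (rij i j i<j) ⇔ (¬ (∃[ k ] (toℕ i < toℕ k × toℕ k < toℕ j × InArc (n + n) (U (lower i)) (U (lower k)) (U (lower j)))))
  edge-εᵢ-εⱼ i j i<j =
    ⇔-trans (QBGEdge⇔QuantumStep (rij i j i<j) {T}
             (λ p → trans (idx-swap {n} a b (swap ⟨ b̄ ⟩ ⟨ ā ⟩ ⟨ p ⟩)) (cong (transpose a b) (idx-swap {n} b̄ ā ⟨ p ⟩))))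
    (⇔-trans (Arc.quantumStep⇔noArcPoint) (¬-cong-⇔ (mk⇔ to-lower from-lower)))
    where
    open εᵢ-εⱼ i j i<j
    module Arc = ArcCriterion signed a<b involution T-a T-b T-between 2 (toℕ j ∸ toℕ i) 2+2*width≡2*ρ
                              (λ sB → LengthChange.εᵢ-εⱼ.lenℕ-∘T sB i j i<j)
    to-lower : ∃ Arc.ArcPoint → ∃[ k ] (toℕ i < toℕ k × toℕ k < toℕ j × InArc (n + n) (U a) (U (lower k)) (U b))
    to-lower (p , a<p , p<b , arc) = k , subst₂ _<_ (toℕ-↑ˡ i n) (sym k≡p) a<p , subst₂ _<_ (sym k≡p) (toℕ-↑ˡ j n) p<b
                                   , subst (λ x → InArc (n + n) (U a) (U x) (U b)) (sym lower-k≡p) arc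
      where
      p<n : toℕ p < n
      p<n = <-trans p<b (lower<n j)
      k = fromℕ< p<n
      k≡p : toℕ k ≡ toℕ p
      k≡p = toℕ-fromℕ< p<n
      lower-k≡p : lower k ≡ p
      lower-k≡p = toℕ-injective (trans (toℕ-↑ˡ k n) k≡p)
    from-lower : ∃[ k ] (toℕ i < toℕ k × toℕ k < toℕ j × InArc (n + n) (U a) (U (lower k)) (U b)) → ∃ Arc.ArcPoint
    from-lower (k , i<k , k<j , arc) = lower k , subst₂ _<_ (sym (toℕ-↑ˡ i n)) (sym (toℕ-↑ˡ k n)) i<k
                                     , subst₂ _<_ (sym (toℕ-↑ˡ k n)) (sym (toℕ-↑ˡ j n)) k<j , arc

  edge-2εᵢ : (i : Fin n) →
    QBGEdge w (riibar i) ⇔ (¬ (∃[ k ] (pos i <L k × k <L bar (pos i) × InArc (n + n) (U (lower i)) (U (idx k)) (U (opposite (lower i))))))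
  edge-2εᵢ i =
    ⇔-trans (QBGEdge⇔QuantumStep (riibar i) {T} (λ p → idx-swap {n} a ā ⟨ p ⟩))
    (⇔-trans Arc.quantumStep⇔noArcPoint (¬-cong-⇔ (mk⇔ (λ (p , arc) → ⟨ p ⟩ , arc) (λ (k , arc) → idx k , arc))))
    where
    open 2εᵢ i
    size : 2 + 1 * width a ā ≡ 2 * (n ∸ toℕ i)
    size = trans (cong (2 +_) (*-identityˡ (width a ā))) 2+width≡2*ρ
    module Arc = ArcCriterion signed a<ā involution T-a T-ā T-between 1 (n ∸ toℕ i) size
      (λ {B} sB Ba<Bā → trans (LengthChange.2εᵢ.lenℕ-∘T sB i Ba<Bā)
                                (cong (λ x → suc (lenℕ n B + x)) (sym (*-identityˡ (pointsBetween a ā B)))))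

  barredAt-lower : ∀ {p} → U p < n → barredAt U p ≡ 0 × barredAt U (opposite p) ≡ 1
  barredAt-lower {p} Up<n = barredAt-< U (<-≤-trans Up<n (complement-lower (IsSigned.complement signed p) Up<n))

  barredAt-upper : ∀ {p} → n ≤ U p → barredAt U p ≡ 1 × barredAt U (opposite p) ≡ 0
  barredAt-upper {p} n≤Up = 𝟙-yes (U (opposite p) <? U p) Up̄<Up
                          , 𝟙-no (U (opposite (opposite p)) <? U (opposite p))
                                 (λ lt → <-asym Up̄<Up (subst (λ x → U x < U (opposite p)) (opposite-involutive p) lt))
    where
    Up̄<Up : U (opposite p) < U p
    Up̄<Up = <-≤-trans (complement-upper (IsSigned.complement signed p) n≤Up) n≤Up

  -- The halves containing U a and U b fix the barredAt terms of the length formula: for equal signs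
  -- ℓ(w s_α) = ℓ(w) + 1 + C₁ + C₂, for opposite signs ℓ(w s_α) = ℓ(w) + 2 + C₁ + C₂.
  module MixedEdge (i j : Fin n) (i<j : toℕ i < toℕ j) where
    open εᵢ+εⱼ i j i<j public
    L = lenℕ n U
    L′ = lenℕ n (U ∘ T)
    Y = barredAt U
    NoK = ¬ (∃[ k ] (pos i <L k × k <L bar (pos j) × U a < U (idx k) × U (idx k) < U b̄))
    RHS = U a < U b̄ × does (U a <? n) ≡ does (U b̄ <? n) × NoK

    idx≡T : ∀ p → idx (reflection (rijbar i j i<j) ⟨ p ⟩) ≡ T p
    idx≡T p = trans (idx-swap {n} a b̄ (swap ⟨ b ⟩ ⟨ ā ⟩ ⟨ p ⟩)) (cong (transpose a b̄) (idx-swap {n} b ā ⟨ p ⟩))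

    C₁≡0⇔NoK : C₁ ≡ 0 ⇔ NoK
    C₁≡0⇔NoK = mk⇔ (λ C₁≡0 (k , a<k , k<b̄ , window) → Equivalence.to (pointsIn≡0⇔ a b̄ (U a) (U b̄) U) C₁≡0 (idx k) a<k k<b̄ window)
                   (λ noK → Equivalence.from (pointsIn≡0⇔ a b̄ (U a) (U b̄) U) (λ p a<p p<b̄ window → noK (⟨ p ⟩ , a<p , p<b̄ , window)))

    0<ρ : 0 < ρ
    0<ρ = subst (0 <_) width-a-b̄+2 (≤-trans (s≤s z≤n) (m≤n+m 2 (width a b̄)))

    true≢false : ¬ true ≡ false
    true≢false ()

    module Ascending (Ua<Ub̄ : U a < U b̄) where
      formula : 2 * L′ + (Y a + Y b) ≡ 2 * L + 2 + 2 * C₁ + 2 * C₂ + (Y ā + Y b̄)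
      formula = 2*lenℕ-∘T Ua<Ub̄

      same-sign : Y a + Y b ≡ 1 → Y ā + Y b̄ ≡ 1 → 𝟙 (U b <? U a) * 𝟙 (U a <? U ā) ≡ 0 →
                  does (U a <? n) ≡ does (U b̄ <? n) → QuantumStep L′ L ρ ⇔ RHS
      same-sign odd odd′ corner signs = ⇔-trans (QuantumStep-up {ρ = ρ} 0<ρ L′≡) (mk⇔
        (λ sum≡0 → Ua<Ub̄ , signs , Equivalence.to C₁≡0⇔NoK (m+n≡0⇒m≡0 C₁ sum≡0))
        (λ (_ , _ , noK) → let C₁≡0 = Equivalence.from C₁≡0⇔NoK noK in
           cong₂ _+_ C₁≡0 (m+n≡0⇒m≡0 C₂ (trans pointsBetween-shifted (cong₂ _+_ C₁≡0 corner)))))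
        where
        halve : ∀ l′ l c d → 2 * l′ + 1 ≡ 2 * l + 2 + 2 * c + 2 * d + 1 → l′ ≡ suc (l + (c + d))
        halve l′ l c d e = *-cancelˡ-≡ l′ _ 2 (trans (+-cancelʳ-≡ 1 _ _ e) (regroup l c d))
          where
          regroup : ∀ l c d → 2 * l + 2 + 2 * c + 2 * d ≡ 2 * suc (l + (c + d))
          regroup = solve-∀
        L′≡ : L′ ≡ suc (L + (C₁ + C₂))
        L′≡ = halve L′ L C₁ C₂ (trans (cong (2 * L′ +_) (sym odd)) (trans formula (cong (2 * L + 2 + 2 * C₁ + 2 * C₂ +_) odd′)))

      opposite-signs : Y a ≡ 0 → Y b ≡ 0 → Y ā ≡ 1 → Y b̄ ≡ 1 → ¬ QuantumStep L′ L ρ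
      opposite-signs ya yb yā yb̄ q = 0≢1+n (sym (Equivalence.to (QuantumStep-up {ρ = ρ} 0<ρ L′≡) q))
        where
        halve : ∀ l′ l c d → 2 * l′ + (0 + 0) ≡ 2 * l + 2 + 2 * c + 2 * d + (1 + 1) → l′ ≡ suc (l + suc (c + d))
        halve l′ l c d e = *-cancelˡ-≡ l′ _ 2 (trans (sym (+-identityʳ (2 * l′))) (trans e (regroup l c d)))
          where
          regroup : ∀ l c d → 2 * l + 2 + 2 * c + 2 * d + (1 + 1) ≡ 2 * suc (l + suc (c + d))
          regroup = solve-∀
        L′≡ : L′ ≡ suc (L + suc (C₁ + C₂))
        L′≡ = halve L′ L C₁ C₂ (trans (cong (2 * L′ +_) (sym (cong₂ _+_ ya yb)))
                                      (trans formula (cong (2 * L + 2 + 2 * C₁ + 2 * C₂ +_) (cong₂ _+_ yā yb̄))))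

      by-signs : Dec (U a < n) → Dec (U b < n) → QuantumStep L′ L ρ ⇔ RHS
      by-signs (yes x<n) (yes y<n) = mk⇔ (λ q → ⊥-elim (opposite-signs (proj₁ (barredAt-lower x<n)) (proj₁ (barredAt-lower y<n))
                                                                      (proj₂ (barredAt-lower x<n)) (proj₂ (barredAt-lower y<n)) q))
        (λ (_ , signs , _) → ⊥-elim (true≢false (trans (sym (dec-true (U a <? n) x<n))
                                      (trans signs (dec-false (U b̄ <? n) (≤⇒≯ (complement-lower (IsSigned.complement signed b) y<n)))))))
      by-signs (yes x<n) (no y≮n) = same-sign
        (cong₂ _+_ (proj₁ (barredAt-lower x<n)) (proj₁ (barredAt-upper (≮⇒≥ y≮n))))
        (cong₂ _+_ (proj₂ (barredAt-lower x<n)) (proj₂ (barredAt-upper (≮⇒≥ y≮n))))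
        (cong (_* 𝟙 (U a <? U ā)) (𝟙-no (U b <? U a) (λ y<x → y≮n (<-trans y<x x<n))))
        (trans (dec-true (U a <? n) x<n) (sym (dec-true (U b̄ <? n) (complement-upper (IsSigned.complement signed b) (≮⇒≥ y≮n)))))
      by-signs (no x≮n) (yes y<n) = same-sign
        (cong₂ _+_ (proj₁ (barredAt-upper (≮⇒≥ x≮n))) (proj₁ (barredAt-lower y<n)))
        (cong₂ _+_ (proj₂ (barredAt-upper (≮⇒≥ x≮n))) (proj₂ (barredAt-lower y<n)))
        (trans (cong (𝟙 (U b <? U a) *_)
                     (𝟙-no (U a <? U ā) (λ x<x̄ → x≮n (<-trans x<x̄ (complement-upper (IsSigned.complement signed a) (≮⇒≥ x≮n))))))
               (*-zeroʳ (𝟙 (U b <? U a))))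
        (trans (dec-false (U a <? n) x≮n) (sym (dec-false (U b̄ <? n) (≤⇒≯ (complement-lower (IsSigned.complement signed b) y<n)))))
      by-signs (no x≮n) (no y≮n) = ⊥-elim (x≮n (<-trans Ua<Ub̄ (complement-upper (IsSigned.complement signed b) (≮⇒≥ y≮n))))

    descending : U b̄ < U a → ¬ QuantumStep L′ L ρ
    descending Ub̄<Ua = no-quantum-step {A = A} {V = A′} {c₁ = C₁′} {c₂ = C₂′}
      (+-mono-≤ (𝟙≤1 (V (opposite a) <? V a)) (𝟙≤1 (V (opposite b) <? V b)))
      (+-mono-≤ (𝟙≤1 (V (opposite ā) <? V ā)) (𝟙≤1 (V (opposite b̄) <? V b̄)))
      (subst (C₁′ + 2 ≤_) width-a-b̄+2 (+-monoˡ-≤ 2 (pointsIn≤width a b̄ (V a) (V b̄) V)))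
      (subst (C₂′ + 2 ≤_) width-b-ā+2 (+-monoˡ-≤ 2 (pointsIn≤width b ā (V₁ b) (V₁ ā) V₁)))
      formula
      where
      V = U ∘ T
      V₁ = V ∘ transpose a b̄
      A = barredAt V a + barredAt V b
      A′ = barredAt V ā + barredAt V b̄
      C₁′ = pointsBetween a b̄ V
      C₂′ = pointsBetween b ā V₁
      Va<Vb̄ : V a < V b̄
      Va<Vb̄ = subst₂ (λ x y → U x < U y) (sym T-a) (sym T-b̄) Ub̄<Ua
      formula : 2 * L + A ≡ 2 * L′ + 2 + 2 * C₁′ + 2 * C₂′ + A′
      formula = trans (cong (λ x → 2 * x + A) (lenℕ-cong n (λ p → cong U (sym (IsSignedInvolution.involutive involution p)))))
                      (LengthChange.εᵢ+εⱼ.2*lenℕ-∘T (IsSigned-∘ signed involution) i j i<j Va<Vb̄)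

    by-order : Tri (U a < U b̄) (U a ≡ U b̄) (U b̄ < U a) → QuantumStep L′ L ρ ⇔ RHS
    by-order (tri< lt _ _) = Ascending.by-signs lt (U a <? n) (U b <? n)
    by-order (tri≈ _ e _) = ⊥-elim (lower≢upper i j (IsSigned.injective signed e))
    by-order (tri> _ _ gt) = mk⇔ (λ q → ⊥-elim (descending gt q)) (λ r → ⊥-elim (<-asym gt (proj₁ r)))

  edge-εᵢ+εⱼ : (i j : Fin n) (i<j : toℕ i < toℕ j) →
    QBGEdge w (rijbar i j i<j) ⇔ (U (lower i) < U (opposite (lower j)) × does (U (lower i) <? n) ≡ does (U (opposite (lower j)) <? n)
      × ¬ (∃[ k ] (pos i <L k × k <L bar (pos j) × U (lower i) < U (idx k) × U (idx k) < U (opposite (lower j)))))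
  edge-εᵢ+εⱼ i j i<j = ⇔-trans (QBGEdge⇔QuantumStep (rijbar i j i<j) {T} idx≡T) (by-order (<-cmp (U a) (U b̄)))
    where open MixedEdge i j i<j


proposition5p7 : (n : ℕ) → (w : SignedPerm n) →
    ((i j : Fin n) → (h : toℕ i < toℕ j) →
      QBGEdge w (rij i j h) ⇔
        (¬ (∃[ k ] (toℕ i < toℕ k × toℕ k < toℕ j
              × fun w (pos i) ≺[ fun w (pos i) ] fun w (pos k)
              × fun w (pos k) ≺[ fun w (pos i) ] fun w (pos j)))))
    × ((i j : Fin n) → (h : toℕ i < toℕ j) →
      QBGEdge w (rijbar i j h) ⇔
        (fun w (pos i) <L fun w (bar (pos j))
          × sign (fun w (pos i)) ≡ sign (fun w (bar (pos j)))
          × ¬ (∃[ k ] (pos i <L k × k <L bar (pos j)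
              × fun w (pos i) <L fun w k × fun w k <L fun w (bar (pos j))))))
    × ((i : Fin n) →
      QBGEdge w (riibar i) ⇔
        (¬ (∃[ k ] (pos i <L k × k <L bar (pos i)
              × fun w (pos i) ≺[ fun w (pos i) ] fun w k
              × fun w k ≺[ fun w (pos i) ] fun w (bar (pos i))))))
proposition5p7 n w = edge-εᵢ-εⱼ , edge-εᵢ+εⱼ , edge-2εᵢ
  where open Encoding w
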